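{- Let $R$ be a commutative integral domain of characteristic $0$, $d\ge1$, $\boldsymbol\kappa=(k_1,\dots,k_d)\in\mathbb{N}_0^d$ and $\mathbf{s}=(s_1,\dots,s_d)\in\mathbb{Z}^d$ with $s:=s_1+\cdots+s_d\ge0$ and $k_i+s_i\ge0$ for $i=1,\dots,d$. Then $$\sum_{\boldsymbol\tau\in\mathbb{N}_0^d}\langle \mathsf{S}^{(\boldsymbol\tau;0)},w_{(\boldsymbol\kappa+\mathbf{s};0)}\rangle\cdot\langle \mathsf{M}^{(\boldsymbol\tau;0)},w_{(\boldsymbol\kappa;s)}\rangle=(-1)^s\binom{k_1+s_1}{k_1}\cdots\binom{k_d+s_d}{k_d}.$$
   Context: For $\boldsymbol\tau=(t_1,\dots,t_d)\in\mathbb{N}_0^d$ and $m\in\mathbb{N}_0$, $(\boldsymbol\tau;m)$ denotes the tuple $(t_1,\dots,t_d;m)$, and $w_{(t_1,\dots,t_d;m)}=X^{t_1}Y\cdots X^{t_d}YX^{m}\in R\langle X,Y\rangle$; $(\boldsymbol\kappa+\mathbf{s};0)=(k_1+s_1,\dots,k_d+s_d;0)$. $\langle\,,\rangle$ is the $R$-bilinear pairing on $R\langle X,Y\rangle$ for which the words in $X,Y$ are orthonormal. $Y^{(0)}=Y$, $Y^{(k+1)}=XY^{(k)}-Y^{(k)}X$, and $\mathsf{M}^{(t_1,\dots,t_d;m)}=Y^{(t_1)}\cdots Y^{(t_d)}X^m$. With $\sqcup\!\sqcup$ the shuffle product, $\mathsf{S}^{(t_1,\dots,t_d;m)}$ is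 defined by $P_1=X^{t_1}Y$, $P_i=(P_{i-1}\sqcup\!\sqcup X^{t_i})Y$ ($i=2,\dots,d$), $\mathsf{S}^{(t_1,\dots,t_d;m)}=P_d\sqcup\!\sqcup X^{m}$. -}

module Defs where

open import Level using (Level)
open import Algebra.Bundles using (CommutativeRing)
open import Data.Nat as ℕ using (ℕ; zero; suc)
open import Data.Nat.Combinatorics using (_C_)
open import Data.Integer as ℤ using (ℤ; +_; -[1+_]; ∣_∣)
open import Data.List as List using (List; []; _∷_; _++_; concatMap; map; foldr; replicate)
import Data.List.Properties as ListP
open import Data.Vec as Vec using (Vec; []; _∷_)
open import Data.Product using (_×_; _,_)
open import Data.Sum using (_⊎_)
open import Relation.Nullary using (¬_; yes; no)
open import Relation.Binary.PropositionalEquality using (_≡_; refl)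
open import Relation.Binary.Definitions using (DecidableEquality)

data Letter : Set where
  X Y : Letter

_≟L_ : DecidableEquality Letter
X ≟L X = yes refl
X ≟L Y = no λ ()
Y ≟L X = no λ ()
Y ≟L Y = yes refl

Word : Set
Word = List Letter

_≟W_ : DecidableEquality Word
_≟W_ = ListP.≡-dec _≟L_

Xw : ℕ → Word
Xw n = replicate n X

-- shuffle product of two words, as the list of all shuffles (with multiplicity)
shuffleW : Word → Word → List Word
shuffleW [] v = v ∷ []
shuffleW (a ∷ u) [] = (a ∷ u) ∷ []
shuffleW (a ∷ u) (b ∷ v) =
  map (a ∷_) (shuffleW u (b ∷ v)) ++ map (b ∷_) (shuffleW (a ∷ u) v)

wWord : List ℕ → ℕ → Word
wWord ts m = concatMap (λ t → Xw t ++ (Y ∷ [])) ts ++ Xw m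

module RingDefs {c ℓ : Level} (R : CommutativeRing c ℓ) where
  open CommutativeRing R

  ofℕ : ℕ → Carrier
  ofℕ zero = 0#
  ofℕ (suc n) = 1# + ofℕ n

  ofℤ : ℤ → Carrier
  ofℤ (+ n) = ofℕ n
  ofℤ -[1+ n ] = - ofℕ (suc n)

  IsIntegralDomain : Set (c Level.⊔ ℓ)
  IsIntegralDomain =
    (¬ (1# ≈ 0#)) × (∀ x y → x * y ≈ 0# → (x ≈ 0#) ⊎ (y ≈ 0#))

  CharacteristicZero : Set ℓ
  CharacteristicZero = ∀ n → ¬ (ofℕ (suc n) ≈ 0#)

  sumR : List Carrier → Carrier
  sumR = foldr _+_ 0#

  -- Noncommutative polynomials R⟨X,Y⟩ as formal R-linear combinations
  -- of words (a list of (coefficient, word) terms, read as their sum).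

  Poly : Set c
  Poly = List (Carrier × Word)

  word : Word → Poly
  word w = (1# , w) ∷ []

  _⊕_ : Poly → Poly → Poly
  P ⊕ Q = P ++ Q

  ⊖_ : Poly → Poly
  ⊖ P = map (λ { (a , w) → (- a , w) }) P

  _⊗_ : Poly → Poly → Poly
  P ⊗ Q = concatMap (λ { (a , u) → map (λ { (b , v) → (a * b , u ++ v) }) Q }) P

  _ш_ : Poly → Poly → Poly
  P ш Q = concatMap (λ { (a , u) → concatMap (λ { (b , v) →
            map (λ w → (a * b , w)) (shuffleW u v) }) Q }) P

  ⟨_,_⟩ : Poly → Poly → Carrier
  ⟨ P , Q ⟩ = sumR (concatMap (λ { (a , u) → map (λ { (b , v) →
                 coef a b u v }) Q }) P)
    where
    coef : Carrier → Carrier → Word → Word → Carrier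
    coef a b u v with u ≟W v
    ... | yes _ = a * b
    ... | no _  = 0#

  Xp Yp : Poly
  Xp = word (X ∷ [])
  Yp = word (Y ∷ [])

  Xpow : ℕ → Poly
  Xpow n = word (Xw n)

  Yder : ℕ → Poly
  Yder zero = Yp
  Yder (suc k) = (Xp ⊗ Yder k) ⊕ (⊖ (Yder k ⊗ Xp))

  M : List ℕ → ℕ → Poly
  M ts m = foldr (λ t P → Yder t ⊗ P) (Xpow m) ts

  -- P_1 = X^{t1} Y, P_i = (P_{i-1} ш X^{t_i}) Y ; starting from P_0 = 1
  -- (note (1 ш X^{t1}) Y = X^{t1} Y, so this agrees with the paper for d ≥ 1)
  Pchain : Poly → List ℕ → Poly
  Pchain P [] = P
  Pchain P (t ∷ ts) = Pchain ((P ш Xpow t) ⊗ Yp) ts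

  S : List ℕ → ℕ → Poly
  S ts m = Pchain (word []) ts ш Xpow m

box : (d B : ℕ) → List (Vec ℕ d)
box zero B = [] ∷ []
box (suc d) B = concatMap (λ t → map (t ∷_) (box d B)) (List.upTo (suc B))

sumℤ : ∀ {d} → Vec ℤ d → ℤ
sumℤ = Vec.foldr _ ℤ._+_ (+ 0)

-- (κ + s) as a vector of naturals (entries are assumed ≥ 0)
addNat : ∀ {d} → Vec ℕ d → Vec ℤ d → Vec ℕ d
addNat κ s = Vec.zipWith (λ k t → ∣ + k ℤ.+ t ∣) κ s

binomProd : ∀ {d} → Vec ℕ d → Vec ℤ d → ℕ
binomProd κ s = Vec.foldr _ ℕ._*_ 1 (Vec.zipWith (λ k t → ∣ + k ℤ.+ t ∣ C k) κ s)

{-# OPTIONS --safe #-}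
-- The coefficient of w in u ш X^t is the number
-- of ways of deleting t letters X from w to obtain u, so the last factor of S^(τ;0) spreads t deletions
-- over the blocks of w_(κ+s;0) with binomial weights; and since Y^(t) = ∑ᵢ (−1)^(t−i) C(t,i) X^i Y X^(t−i),
-- the pairing with M^(τ;0) is a signed product of binomials. Peeling off the last coordinate of τ by
-- induction on d, the sum over it collapses by trinomial revision, Vandermonde's identity and the
-- alternating inversion ∑ₙ (−1)^(A−n) C(A,n) C(d+n, k−A+n) = C(d,k).
module Submission where

open import Defs
open import Level using (Level)
open import Algebra.Bundles using (CommutativeRing)
open import Data.Nat as ℕ using (ℕ; zero; suc; _∸_; _≤_; _<_; z≤n; s≤s)
import Data.Nat.Properties as ℕ
open import Data.Nat.ListAction using (sum)
open import Data.Nat.Tactic.RingSolver using (solve-∀)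
open import Data.Integer as ℤ using (ℤ; +_; -[1+_]; ∣_∣)
import Data.Integer.Properties as ℤ
open import Data.Fin using (Fin)
open import Data.List using (List; []; _∷_; _++_; _∷ʳ_; map; concatMap; upTo)
import Data.List.Properties as List
open import Data.Vec as Vec using (Vec; []; _∷_; toList; lookup)
import Data.Vec.Properties as Vec
open import Data.Product using (_×_; _,_; proj₂)
open import Function using (_∘_)
open import Relation.Nullary using (Dec; yes; no; contradiction)
open import Relation.Binary.PropositionalEquality as ≡ using (_≡_; _≢_)

module NatArithmetic where
  open import Data.Nat
  open import Data.Nat.Properties
  open import Relation.Binary.PropositionalEquality
  open ≡-Reasoning

  m∸n≡1+[m∸1+n] : ∀ m n → n < m → m ∸ n ≡ suc (m ∸ suc n)
  m∸n≡1+[m∸1+n] m n n<m = +-∸-assoc 1 n<m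

  m+n∸[n+o]≡m∸o : ∀ m n o → m + n ∸ (n + o) ≡ m ∸ o
  m+n∸[n+o]≡m∸o m n o = trans (cong (_∸ (n + o)) (+-comm m n)) ([m+n]∸[m+o]≡n∸o n m o)

  [m+n+o]∸[n+p]≡[m+o]∸p : ∀ m n o p → m + n + o ∸ (n + p) ≡ m + o ∸ p
  [m+n+o]∸[n+p]≡[m+o]∸p m n o p = trans (cong (_∸ (n + p)) (swap m n o)) ([m+n]∸[m+o]≡n∸o n (m + o) p)
    where
    swap : ∀ m n o → m + n + o ≡ n + (m + o)
    swap = solve-∀

  [m+n+o]∸p∸n≡[m+o]∸p : ∀ m n o p → m + n + o ∸ p ∸ n ≡ m + o ∸ p
  [m+n+o]∸p∸n≡[m+o]∸p m n o p = begin
    m + n + o ∸ p ∸ n     ≡⟨ ∸-+-assoc (m + n + o) p n ⟩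
    m + n + o ∸ (p + n)   ≡⟨ cong (m + n + o ∸_) (+-comm p n) ⟩
    m + n + o ∸ (n + p)   ≡⟨ [m+n+o]∸[n+p]≡[m+o]∸p m n o p ⟩
    m + o ∸ p             ∎

  ∸-∸-shift : ∀ {A n k} d → n ≤ A → A ∸ n ≤ k → d + n ∸ (k ∸ (A ∸ n)) ≡ A + d ∸ k
  ∸-∸-shift {A} {n} {k} d n≤A c≤k = begin
    d + n ∸ (k ∸ c)               ≡⟨ cong (_∸ (k ∸ c)) (+-comm d n) ⟩
    n + d ∸ (k ∸ c)               ≡⟨ [m+n]∸[m+o]≡n∸o c (n + d) (k ∸ c) ⟨
    c + (n + d) ∸ (c + (k ∸ c))   ≡⟨ cong₂ _∸_ (sym (+-assoc c n d)) (m+[n∸m]≡n c≤k) ⟩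
    c + n + d ∸ k                 ≡⟨ cong (λ a → a + d ∸ k) (m∸n+n≡m n≤A) ⟩
    A + d ∸ k                     ∎
    where
    c = A ∸ n

  ∸-+-invariant : ∀ {a e t S m} b m′ → e ≤ a → e ≤ t → b + m′ + (t ∸ e) ≡ S + m →
                  (a ∸ e) + b + m′ + t ≡ a + S + m
  ∸-+-invariant {a} {e} {t} {S} {m} b m′ e≤a e≤t eq = begin
    (a ∸ e) + b + m′ + t                ≡⟨ cong (λ z → (a ∸ e) + b + m′ + z) (m∸n+n≡m e≤t) ⟨
    (a ∸ e) + b + m′ + ((t ∸ e) + e)    ≡⟨ regroup (a ∸ e) b m′ (t ∸ e) e ⟩
    (b + m′ + (t ∸ e)) + ((a ∸ e) + e)  ≡⟨ cong₂ _+_ eq (m∸n+n≡m e≤a) ⟩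
    S + m + a                           ≡⟨ rotate S m a ⟩
    a + S + m                           ∎
    where
    regroup : ∀ x b m′ y e → x + b + m′ + (y + e) ≡ (b + m′ + y) + (x + e)
    regroup = solve-∀
    rotate : ∀ S m a → S + m + a ≡ a + S + m
    rotate = solve-∀

  sum-∷ʳ : ∀ {n} (as : Vec ℕ n) a → Vec.sum (as Vec.∷ʳ a) ≡ Vec.sum as + a
  sum-∷ʳ []        a = +-identityʳ a
  sum-∷ʳ (a₀ ∷ as) a = trans (cong (_+_ a₀) (sum-∷ʳ as a)) (sym (+-assoc a₀ _ a))

module Binomial where
  open import Data.Nat
  open import Data.Nat.Properties
  open import Data.Nat.Combinatorics using (_C_; k>n⇒nCk≡0; nCk+nC[k+1]≡[n+1]C[k+1])
  open import Relation.Binary.PropositionalEquality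
  open import Algebra.Properties.CommutativeSemigroup +-commutativeSemigroup using (interchange)
  open ≡-Reasoning
  open NatArithmetic using (m∸n≡1+[m∸1+n])

  binom : ℕ → ℕ → ℕ
  binom n       zero    = 1
  binom zero    (suc k) = 0
  binom (suc n) (suc k) = binom n k + binom n (suc k)

  binom≡C : ∀ n k → binom n k ≡ n C k
  binom≡C n       zero    = refl
  binom≡C zero    (suc k) = sym (k>n⇒nCk≡0 {n = 0} {k = suc k} z<s)
  binom≡C (suc n) (suc k) =
    trans (cong₂ _+_ (binom≡C n k) (binom≡C n (suc k))) (nCk+nC[k+1]≡[n+1]C[k+1] n k)

  binom-< : ∀ {n k} → n < k → binom n k ≡ 0
  binom-< {zero}  {suc k} _         = refl
  binom-< {suc n} {suc k} (s≤s n<k) = cong₂ _+_ (binom-< n<k) (binom-< (m<n⇒m<1+n n<k))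

  binom≢0⇒≤ : ∀ n k → binom n k ≢ 0 → k ≤ n
  binom≢0⇒≤ n k binom≢0 with k ≤? n
  ... | yes k≤n = k≤n
  ... | no  k≰n = contradiction (binom-< (≰⇒> k≰n)) binom≢0

  -- both sides count the pairs of disjoint e- and k-subsets of an a-set
  binom-revision : ∀ a e k → binom a e * binom (a ∸ e) k ≡ binom a k * binom (a ∸ k) e
  binom-revision zero    zero    zero    = refl
  binom-revision zero    zero    (suc k) = refl
  binom-revision zero    (suc e) zero    = refl
  binom-revision zero    (suc e) (suc k) = refl
  binom-revision (suc a) zero    zero    = refl
  binom-revision (suc a) zero    (suc k) = *-comm 1 (binom (suc a) (suc k))
  binom-revision (suc a) (suc e) zero    = *-comm (binom (suc a) (suc e)) 1
  binom-revision (suc a) (suc e) (suc k) = begin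
    T (suc a) (suc e) (suc k)                             ≡⟨ pascal a e k ⟩
    T a e (suc k) + (T a (suc e) k + T a (suc e) (suc k)) ≡⟨ cong₂ _+_ (binom-revision a e (suc k))
                                                               (cong₂ _+_ (binom-revision a (suc e) k)
                                                                          (binom-revision a (suc e) (suc k))) ⟩
    T a (suc k) e + (T a k (suc e) + T a (suc k) (suc e)) ≡⟨ swap (T a (suc k) e) (T a k (suc e)) _ ⟩
    T a k (suc e) + (T a (suc k) e + T a (suc k) (suc e)) ≡⟨ pascal a k e ⟨
    T (suc a) (suc k) (suc e)                             ∎
    where
    T : ℕ → ℕ → ℕ → ℕ
    T a e k = binom a e * binom (a ∸ e) k

    swap : ∀ x y z → x + (y + z) ≡ y + (x + z)
    swap = solve-∀

    split : ∀ a e k → binom a (suc e) * binom (a ∸ e) (suc k)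
                    ≡ binom a (suc e) * binom (a ∸ suc e) k + binom a (suc e) * binom (a ∸ suc e) (suc k)
    split a e k with e <? a
    ... | yes e<a = trans (cong (λ n → binom a (suc e) * binom n (suc k)) (m∸n≡1+[m∸1+n] a e e<a))
                          (*-distribˡ-+ (binom a (suc e)) _ _)
    ... | no  e≮a rewrite binom-< {a} {suc e} (s≤s (≮⇒≥ e≮a)) = refl

    pascal : ∀ a e k → T (suc a) (suc e) (suc k) ≡ T a e (suc k) + (T a (suc e) k + T a (suc e) (suc k))
    pascal a e k = trans (*-distribʳ-+ _ (binom a e) (binom a (suc e))) (cong (_+_ (T a e (suc k))) (split a e k))

  -- C[ q , x − m ] is binom q (x − m) for the untruncated difference: it vanishes when x < m
  C[_,_−_] : ℕ → ℕ → ℕ → ℕ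
  C[ q , x     − zero  ] = binom q x
  C[ q , zero  − suc m ] = 0
  C[ q , suc x − suc m ] = C[ q , x − m ]

  C[−]-pascal : ∀ q x m → C[ suc q , suc x − m ] ≡ C[ q , suc x − m ] + C[ q , x − m ]
  C[−]-pascal q x       zero          = +-comm (binom q x) (binom q (suc x))
  C[−]-pascal q zero    (suc zero)    = refl
  C[−]-pascal q zero    (suc (suc m)) = refl
  C[−]-pascal q (suc x) (suc m)       = C[−]-pascal q x m

  C[−]-< : ∀ q {x m} → x < m → C[ q , x − m ] ≡ 0
  C[−]-< q {zero}  {suc m} _         = refl
  C[−]-< q {suc x} {suc m} (s≤s x<m) = C[−]-< q x<m

  C[+−] : ∀ q m x → C[ q , m + x − m ] ≡ binom q x
  C[+−] q zero    x = refl
  C[+−] q (suc m) x = C[+−] q m x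

  C[0−] : ∀ q q′ m → C[ q , 0 − m ] ≡ C[ q′ , 0 − m ]
  C[0−] q q′ zero    = refl
  C[0−] q q′ (suc m) = refl

  ∏binom : ∀ {n} → Vec ℕ n → Vec ℕ n → ℕ
  ∏binom []       []       = 1
  ∏binom (a ∷ as) (k ∷ ks) = binom a k * ∏binom as ks

  ∑∸ : ∀ {n} → Vec ℕ n → Vec ℕ n → ℕ
  ∑∸ []       []       = 0
  ∑∸ (a ∷ as) (k ∷ ks) = (a ∸ k) + ∑∸ as ks

  ∏binom-∷ʳ : ∀ {n} (as ks : Vec ℕ n) a k → ∏binom (as Vec.∷ʳ a) (ks Vec.∷ʳ k) ≡ ∏binom as ks * binom a k
  ∏binom-∷ʳ []        []        a k = trans (*-identityʳ _) (sym (*-identityˡ _))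
  ∏binom-∷ʳ (a₀ ∷ as) (k₀ ∷ ks) a k =
    trans (cong (binom a₀ k₀ *_) (∏binom-∷ʳ as ks a k)) (sym (*-assoc (binom a₀ k₀) _ _))

  ∏binom≢0⇒sum≡ : ∀ {n} (as ks : Vec ℕ n) → ∏binom as ks ≢ 0 → Vec.sum as ≡ ∑∸ as ks + Vec.sum ks
  ∏binom≢0⇒sum≡ []       []       _   = refl
  ∏binom≢0⇒sum≡ (a ∷ as) (k ∷ ks) ∏≢0 = begin
    a + Vec.sum as                          ≡⟨ cong₂ _+_ (m∸n+n≡m k≤a) (sym (∏binom≢0⇒sum≡ as ks (∏≢0 ∘ ∏≡0))) ⟨
    (a ∸ k) + k + (∑∸ as ks + Vec.sum ks)   ≡⟨ interchange (a ∸ k) k (∑∸ as ks) (Vec.sum ks) ⟩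
    (a ∸ k) + ∑∸ as ks + (k + Vec.sum ks)   ∎
    where
    k≤a : k ≤ a
    k≤a = binom≢0⇒≤ a k (∏≢0 ∘ cong (_* ∏binom as ks))

    ∏≡0 : ∏binom as ks ≡ 0 → binom a k * ∏binom as ks ≡ 0
    ∏≡0 ∏≡0 = trans (cong (binom a k *_) ∏≡0) (*-zeroʳ (binom a k))

module Words where
  open import Data.List
  open import Data.List.Properties
  open import Relation.Binary.PropositionalEquality
  open ≡-Reasoning

  block : ℕ → Word
  block k = Xw k ++ Y ∷ []

  wWord-∷ : ∀ k ks m → wWord (k ∷ ks) m ≡ Xw k ++ Y ∷ wWord ks m
  wWord-∷ k ks m = trans (++-assoc (block k) _ (Xw m)) (++-assoc (Xw k) (Y ∷ []) _)

  Xw-suc : ∀ m → Xw (suc m) ≡ Xw m ∷ʳ X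
  Xw-suc zero    = refl
  Xw-suc (suc m) = cong (X ∷_) (Xw-suc m)

  wWord-suc : ∀ ks m → wWord ks (suc m) ≡ wWord ks m ∷ʳ X
  wWord-suc ks m = begin
    concatMap block ks ++ Xw (suc m)       ≡⟨ cong (concatMap block ks ++_) (Xw-suc m) ⟩
    concatMap block ks ++ (Xw m ∷ʳ X)      ≡⟨ ++-assoc (concatMap block ks) (Xw m) _ ⟨
    (concatMap block ks ++ Xw m) ∷ʳ X      ∎

  wWord-∷ʳ : ∀ ks k → wWord (ks ∷ʳ k) 0 ≡ wWord ks k ∷ʳ Y
  wWord-∷ʳ ks k = begin
    concatMap block (ks ∷ʳ k) ++ []        ≡⟨ ++-identityʳ _ ⟩
    concatMap block (ks ∷ʳ k)              ≡⟨ concatMap-++ block ks (k ∷ []) ⟩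
    concatMap block ks ++ (block k ++ [])  ≡⟨ cong (concatMap block ks ++_) (++-identityʳ (block k)) ⟩
    concatMap block ks ++ block k          ≡⟨ ++-assoc (concatMap block ks) (Xw k) _ ⟨
    (concatMap block ks ++ Xw k) ∷ʳ Y      ∎

open NatArithmetic
open Binomial
open Words

module Pairings {c ℓ : Level} (R : CommutativeRing c ℓ) where
  open CommutativeRing R hiding (zero)
  open RingDefs R
  open import Algebra.Properties.Ring ring using (-‿distribˡ-*; -‿+-comm; -0#≈0#; -‿involutive)
  open import Algebra.Solver.Ring.NaturalCoefficients.Default commutativeSemiring
    using (solve; _:+_; _:*_; _:=_; con)
  open import Algebra.Properties.CommutativeSemigroup +-commutativeSemigroup
    using () renaming (interchange to +-interchange)
  open import Relation.Binary.Reasoning.Setoid setoid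

  -‿distribˡ-*³ : ∀ x y z → - x * y * z ≈ - (x * y * z)
  -‿distribˡ-*³ x y z = trans (*-congʳ (sym (-‿distribˡ-* x y))) (sym (-‿distribˡ-* (x * y) z))

  module _ {a : Level} {A : Set a} where

    ∑ : List A → (A → Carrier) → Carrier
    ∑ xs f = sumR (map f xs)

    infix 6.5 ∑
    syntax ∑ xs (λ x → e) = ∑[ x ∈ xs ] e

    ∑-++ : ∀ xs ys f → ∑ (xs ++ ys) f ≈ ∑ xs f + ∑ ys f
    ∑-++ []       ys f = sym (+-identityˡ _)
    ∑-++ (x ∷ xs) ys f = trans (+-congˡ (∑-++ xs ys f)) (sym (+-assoc _ _ _))

    ∑-cong : ∀ xs {f g} → (∀ x → f x ≈ g x) → ∑ xs f ≈ ∑ xs g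
    ∑-cong []       f≈g = refl
    ∑-cong (x ∷ xs) f≈g = +-cong (f≈g x) (∑-cong xs f≈g)

    ∑-zero : ∀ xs {f} → (∀ x → f x ≈ 0#) → ∑ xs f ≈ 0#
    ∑-zero []       f≈0 = refl
    ∑-zero (x ∷ xs) f≈0 = trans (+-cong (f≈0 x) (∑-zero xs f≈0)) (+-identityʳ 0#)

    ∑-+ : ∀ xs f g → ∑[ x ∈ xs ] (f x + g x) ≈ ∑ xs f + ∑ xs g
    ∑-+ []       f g = sym (+-identityʳ 0#)
    ∑-+ (x ∷ xs) f g = trans (+-congˡ (∑-+ xs f g)) (+-interchange _ _ _ _)

    ∑-*ˡ : ∀ xs k f → ∑[ x ∈ xs ] (k * f x) ≈ k * ∑ xs f
    ∑-*ˡ []       k f = sym (zeroʳ k)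
    ∑-*ˡ (x ∷ xs) k f = trans (+-congˡ (∑-*ˡ xs k f)) (sym (distribˡ k _ _))

    ∑-*ʳ : ∀ xs k f → ∑[ x ∈ xs ] (f x * k) ≈ ∑ xs f * k
    ∑-*ʳ []       k f = sym (zeroˡ k)
    ∑-*ʳ (x ∷ xs) k f = trans (+-congˡ (∑-*ʳ xs k f)) (sym (distribʳ k _ _))

    ∑-neg : ∀ xs f → ∑[ x ∈ xs ] (- f x) ≈ - ∑ xs f
    ∑-neg []       f = sym -0#≈0#
    ∑-neg (x ∷ xs) f = trans (+-congˡ (∑-neg xs f)) (-‿+-comm _ _)
  module _ {a b : Level} {A : Set a} {B : Set b} where

    ∑-map : ∀ (xs : List A) (g : A → B) f → ∑ (map g xs) f ≡ ∑[ x ∈ xs ] f (g x)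
    ∑-map xs g f = ≡.cong sumR (≡.sym (List.map-∘ xs))

    ∑-concatMap : ∀ (xs : List A) (g : A → List B) f → ∑ (concatMap g xs) f ≈ ∑[ x ∈ xs ] ∑ (g x) f
    ∑-concatMap []       g f = refl
    ∑-concatMap (x ∷ xs) g f = trans (∑-++ (g x) (concatMap g xs) f) (+-congˡ (∑-concatMap xs g f))

    ∑-comm : ∀ (xs : List A) (ys : List B) (f : A → B → Carrier) →
             ∑[ x ∈ xs ] ∑[ y ∈ ys ] f x y ≈ ∑[ y ∈ ys ] ∑[ x ∈ xs ] f x y
    ∑-comm []       ys f = sym (∑-zero ys (λ _ → refl))
    ∑-comm (x ∷ xs) ys f = trans (+-congˡ (∑-comm xs ys f)) (sym (∑-+ ys (f x) _))

  ∑< : ℕ → (ℕ → Carrier) → Carrier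
  ∑< n f = ∑ (upTo n) f

  infix 6.5 ∑<
  syntax ∑< n (λ i → e) = ∑[ i < n ] e

  ∑<-suc : ∀ n f → ∑< (suc n) f ≡ f 0 + ∑[ i < n ] f (suc i)
  ∑<-suc n f = ≡.cong (λ xs → f 0 + sumR xs)
                      (≡.trans (List.map-applyUpTo suc f n) (≡.sym (List.map-upTo (f ∘ suc) n)))

  ∑<-cong : ∀ n {f g} → (∀ i → i < n → f i ≈ g i) → ∑< n f ≈ ∑< n g
  ∑<-cong zero    f≈g = refl
  ∑<-cong (suc n) {f} {g} f≈g = begin
    ∑< (suc n) f                   ≡⟨ ∑<-suc n f ⟩
    f 0 + ∑[ i < n ] f (suc i)     ≈⟨ +-cong (f≈g 0 (s≤s z≤n)) (∑<-cong n (λ i i<n → f≈g (suc i) (s≤s i<n))) ⟩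
    g 0 + ∑[ i < n ] g (suc i)     ≡⟨ ∑<-suc n g ⟨
    ∑< (suc n) g                   ∎

  ∑<-zero : ∀ n {f} → (∀ i → i < n → f i ≈ 0#) → ∑< n f ≈ 0#
  ∑<-zero n f≈0 = trans (∑<-cong n f≈0) (∑-zero (upTo n) (λ _ → refl))

  ∑<-+ : ∀ n f g → ∑[ i < n ] (f i + g i) ≈ ∑< n f + ∑< n g
  ∑<-+ n = ∑-+ (upTo n)

  ∑<-*ˡ : ∀ n k f → ∑[ i < n ] (k * f i) ≈ k * ∑< n f
  ∑<-*ˡ n = ∑-*ˡ (upTo n)

  ∑<-*ʳ : ∀ n k f → ∑[ i < n ] (f i * k) ≈ ∑< n f * k
  ∑<-*ʳ n = ∑-*ʳ (upTo n)

  ∑<-neg : ∀ n f → ∑[ i < n ] (- f i) ≈ - ∑< n f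
  ∑<-neg n = ∑-neg (upTo n)

  ∑<-comm-∑ : ∀ {a} {A : Set a} n (xs : List A) (f : ℕ → A → Carrier) →
              ∑[ i < n ] ∑[ x ∈ xs ] f i x ≈ ∑[ x ∈ xs ] ∑[ i < n ] f i x
  ∑<-comm-∑ n = ∑-comm (upTo n)

  ∑<-split : ∀ m n f → ∑< (m ℕ.+ n) f ≈ ∑< m f + ∑[ i < n ] f (m ℕ.+ i)
  ∑<-split zero    n f = sym (+-identityˡ _)
  ∑<-split (suc m) n f = begin
    ∑< (suc m ℕ.+ n) f                                           ≡⟨ ∑<-suc (m ℕ.+ n) f ⟩
    f 0 + ∑[ i < m ℕ.+ n ] f (suc i)                             ≈⟨ +-congˡ (∑<-split m n (f ∘ suc)) ⟩
    f 0 + (∑[ i < m ] f (suc i) + ∑[ i < n ] f (suc m ℕ.+ i))    ≈⟨ +-assoc _ _ _ ⟨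
    (f 0 + ∑[ i < m ] f (suc i)) + ∑[ i < n ] f (suc m ℕ.+ i)    ≡⟨ ≡.cong (_+ ∑[ i < n ] f (suc m ℕ.+ i)) (∑<-suc m f) ⟨
    ∑< (suc m) f + ∑[ i < n ] f (suc m ℕ.+ i)                    ∎

  ∑<-last : ∀ n f → ∑< (suc n) f ≈ ∑< n f + f n
  ∑<-last n f = begin
    ∑< (suc n) f                    ≡⟨ ≡.cong (λ k → ∑< k f) (ℕ.+-comm 1 n) ⟩
    ∑< (n ℕ.+ 1) f                  ≈⟨ ∑<-split n 1 f ⟩
    ∑< n f + (f (n ℕ.+ 0) + 0#)     ≈⟨ +-congˡ (+-identityʳ _) ⟩
    ∑< n f + f (n ℕ.+ 0)            ≡⟨ ≡.cong (λ k → ∑< n f + f k) (ℕ.+-identityʳ n) ⟩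
    ∑< n f + f n                    ∎

  ofℕ-+ : ∀ m n → ofℕ (m ℕ.+ n) ≈ ofℕ m + ofℕ n
  ofℕ-+ zero    n = sym (+-identityˡ _)
  ofℕ-+ (suc m) n = trans (+-congˡ (ofℕ-+ m n)) (sym (+-assoc _ _ _))

  ofℕ-* : ∀ m n → ofℕ (m ℕ.* n) ≈ ofℕ m * ofℕ n
  ofℕ-* zero    n = sym (zeroˡ _)
  ofℕ-* (suc m) n = begin
    ofℕ (n ℕ.+ m ℕ.* n)        ≈⟨ ofℕ-+ n (m ℕ.* n) ⟩
    ofℕ n + ofℕ (m ℕ.* n)      ≈⟨ +-cong (sym (*-identityˡ _)) (ofℕ-* m n) ⟩
    1# * ofℕ n + ofℕ m * ofℕ n ≈⟨ distribʳ _ _ _ ⟨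
    (1# + ofℕ m) * ofℕ n       ∎

  ofℕ-1 : ofℕ 1 ≈ 1#
  ofℕ-1 = +-identityʳ 1#

  sign : ℕ → Carrier
  sign zero    = 1#
  sign (suc n) = - sign n

  ofℤ-neg : ∀ i → ofℤ (ℤ.- i) ≈ - ofℤ i
  ofℤ-neg (+ zero)  = sym -0#≈0#
  ofℤ-neg (+ suc n) = refl
  ofℤ-neg -[1+ n ]  = sym (-‿involutive _)

  ofℤ-[-1]^ : ∀ n → ofℤ ((ℤ.- (+ 1)) ℤ.^ n) ≈ sign n
  ofℤ-[-1]^ zero    = ofℕ-1
  ofℤ-[-1]^ (suc n) = begin
    ofℤ ((ℤ.- (+ 1)) ℤ.* (ℤ.- (+ 1)) ℤ.^ n)  ≡⟨ ≡.cong ofℤ (ℤ.-1*i≡-i ((ℤ.- (+ 1)) ℤ.^ n)) ⟩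
    ofℤ (ℤ.- ((ℤ.- (+ 1)) ℤ.^ n))            ≈⟨ ofℤ-neg ((ℤ.- (+ 1)) ℤ.^ n) ⟩
    - ofℤ ((ℤ.- (+ 1)) ℤ.^ n)                ≈⟨ -‿cong (ofℤ-[-1]^ n) ⟩
    - sign n                                 ∎

  binomᴿ : ℕ → ℕ → Carrier
  binomᴿ n k = ofℕ (binom n k)

  binomᴿ-pascal : ∀ n k → binomᴿ (suc n) (suc k) ≈ binomᴿ n k + binomᴿ n (suc k)
  binomᴿ-pascal n k = ofℕ-+ (binom n k) _

  binomᴿ-< : ∀ {n k} → n < k → binomᴿ n k ≈ 0#
  binomᴿ-< n<k = reflexive (≡.cong ofℕ (binom-< n<k))

  binomᴿ-*-congˡ : ∀ a e {x y} → (e ≤ a → x ≈ y) → binomᴿ a e * x ≈ binomᴿ a e * y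
  binomᴿ-*-congˡ a e x≈y with e ℕ.≤? a
  ... | yes e≤a = *-congˡ (x≈y e≤a)
  ... | no  e≰a = trans (*-congʳ C≈0) (trans (zeroˡ _) (sym (trans (*-congʳ C≈0) (zeroˡ _))))
    where
    C≈0 : binomᴿ a e ≈ 0#
    C≈0 = binomᴿ-< (ℕ.≰⇒> e≰a)

  binomᴿ-revision : ∀ a e k → binomᴿ a e * binomᴿ (a ∸ e) k ≈ binomᴿ a k * binomᴿ (a ∸ k) e
  binomᴿ-revision a e k = begin
    binomᴿ a e * binomᴿ (a ∸ e) k       ≈⟨ ofℕ-* (binom a e) _ ⟨
    ofℕ (binom a e ℕ.* binom (a ∸ e) k) ≡⟨ ≡.cong ofℕ (binom-revision a e k) ⟩
    ofℕ (binom a k ℕ.* binom (a ∸ k) e) ≈⟨ ofℕ-* (binom a k) _ ⟩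
    binomᴿ a k * binomᴿ (a ∸ k) e       ∎

  vandermonde : ∀ p q t m → ∑[ e < suc t ] binomᴿ p e * ofℕ C[ q , t ∸ e − m ] ≈ ofℕ C[ p ℕ.+ q , t − m ]
  vandermonde zero q t m = begin
    ∑[ e < suc t ] binomᴿ 0 e * ofℕ C[ q , t ∸ e − m ]
      ≡⟨ ∑<-suc t _ ⟩
    ofℕ 1 * ofℕ C[ q , t − m ] + ∑[ e < t ] 0# * ofℕ C[ q , t ∸ suc e − m ]
      ≈⟨ +-cong (trans (*-congʳ ofℕ-1) (*-identityˡ _)) (∑<-zero t (λ _ _ → zeroˡ _)) ⟩
    ofℕ C[ q , t − m ] + 0#
      ≈⟨ +-identityʳ _ ⟩
    ofℕ C[ q , t − m ] ∎
  vandermonde (suc p) q zero m = begin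
    ofℕ 1 * ofℕ C[ q , 0 − m ] + 0#   ≈⟨ trans (+-identityʳ _) (trans (*-congʳ ofℕ-1) (*-identityˡ _)) ⟩
    ofℕ C[ q , 0 − m ]                 ≡⟨ ≡.cong ofℕ (C[0−] q (suc p ℕ.+ q) m) ⟩
    ofℕ C[ suc p ℕ.+ q , 0 − m ]       ∎
  vandermonde (suc p) q (suc t) m = begin
    ∑[ e < suc (suc t) ] binomᴿ (suc p) e * V (suc t) e
      ≡⟨ ∑<-suc (suc t) _ ⟩
    ofℕ 1 * V (suc t) 0 + ∑[ e < suc t ] binomᴿ (suc p) (suc e) * V t e
      ≈⟨ +-congˡ (∑<-cong (suc t) (λ e _ → trans (*-congʳ (binomᴿ-pascal p e)) (distribʳ _ _ _))) ⟩
    ofℕ 1 * V (suc t) 0 + ∑[ e < suc t ] (binomᴿ p e * V t e + binomᴿ p (suc e) * V t e)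
      ≈⟨ +-congˡ (∑<-+ (suc t) _ _) ⟩
    ofℕ 1 * V (suc t) 0 + (∑[ e < suc t ] binomᴿ p e * V t e + ∑[ e < suc t ] binomᴿ p (suc e) * V t e)
      ≈⟨ trans (+-congˡ (+-comm _ _)) (sym (+-assoc _ _ _)) ⟩
    (ofℕ 1 * V (suc t) 0 + ∑[ e < suc t ] binomᴿ p (suc e) * V t e) + ∑[ e < suc t ] binomᴿ p e * V t e
      ≡⟨ ≡.cong (_+ ∑[ e < suc t ] binomᴿ p e * V t e) (∑<-suc (suc t) _) ⟨
    ∑[ e < suc (suc t) ] binomᴿ p e * V (suc t) e + ∑[ e < suc t ] binomᴿ p e * V t e
      ≈⟨ +-cong (vandermonde p q (suc t) m) (vandermonde p q t m) ⟩
    ofℕ C[ p ℕ.+ q , suc t − m ] + ofℕ C[ p ℕ.+ q , t − m ]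
      ≈⟨ ofℕ-+ C[ p ℕ.+ q , suc t − m ] _ ⟨
    ofℕ (C[ p ℕ.+ q , suc t − m ] ℕ.+ C[ p ℕ.+ q , t − m ])
      ≡⟨ ≡.cong ofℕ (C[−]-pascal (p ℕ.+ q) t m) ⟨
    ofℕ C[ suc p ℕ.+ q , suc t − m ] ∎
    where
    V : ℕ → ℕ → Carrier
    V t e = ofℕ C[ q , t ∸ e − m ]

  [_≤_]·_ : ℕ → ℕ → Carrier → Carrier
  [ zero  ≤ k     ]· x = x
  [ suc c ≤ zero  ]· x = 0#
  [ suc c ≤ suc k ]· x = [ c ≤ k ]· x

  [≤]·-yes : ∀ {c k} x → c ≤ k → [ c ≤ k ]· x ≡ x
  [≤]·-yes x z≤n       = ≡.refl
  [≤]·-yes x (s≤s c≤k) = [≤]·-yes x c≤k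

  [≤]·-no : ∀ {c k} x → k < c → [ c ≤ k ]· x ≡ 0#
  [≤]·-no {suc c} {zero}  x _         = ≡.refl
  [≤]·-no {suc c} {suc k} x (s≤s k<c) = [≤]·-no x k<c

  [≤]·-cong : ∀ c k {x y} → x ≈ y → [ c ≤ k ]· x ≈ [ c ≤ k ]· y
  [≤]·-cong zero    k       x≈y = x≈y
  [≤]·-cong (suc c) zero    x≈y = refl
  [≤]·-cong (suc c) (suc k) x≈y = [≤]·-cong c k x≈y

  sign-pred : ∀ {A n} → n < A → sign (A ∸ n) ≡ - sign (A ∸ suc n)
  sign-pred {A} {n} n<A = ≡.cong sign (m∸n≡1+[m∸1+n] A n n<A)

  ∑-sign-binom-pascal : ∀ A (φ : ℕ → ℕ → Carrier) →
    ∑[ n < suc (suc A) ] sign (suc A ∸ n) * binomᴿ (suc A) n * φ (suc A ∸ n) n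
    ≈ ∑[ n < suc A ] sign (A ∸ n) * binomᴿ A n * φ (A ∸ n) (suc n)
      + - (∑[ n < suc A ] sign (A ∸ n) * binomᴿ A n * φ (suc A ∸ n) n)
  ∑-sign-binom-pascal A φ = begin
    ∑[ n < suc (suc A) ] sign (suc A ∸ n) * binomᴿ (suc A) n * φ (suc A ∸ n) n
      ≡⟨ ∑<-suc (suc A) _ ⟩
    S₀ + ∑[ n < suc A ] sign (A ∸ n) * binomᴿ (suc A) (suc n) * φ (A ∸ n) (suc n)
      ≈⟨ +-congˡ (∑<-cong (suc A) (λ n _ → trans (*-congʳ (trans (*-congˡ (binomᴿ-pascal A n)) (distribˡ _ _ _)))
                                                 (distribʳ _ _ _))) ⟩
    S₀ + ∑[ n < suc A ] (T n + T′ n)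
      ≈⟨ +-congˡ (∑<-+ (suc A) T T′) ⟩
    S₀ + (∑< (suc A) T + ∑< (suc A) T′)
      ≈⟨ trans (sym (+-assoc _ _ _)) (trans (+-congʳ (+-comm _ _)) (+-assoc _ _ _)) ⟩
    ∑< (suc A) T + (S₀ + ∑< (suc A) T′)
      ≈⟨ +-congˡ (+-congˡ (∑<-last A T′)) ⟩
    ∑< (suc A) T + (S₀ + (∑< A T′ + T′ A))
      ≈⟨ +-congˡ (+-congˡ (+-cong (∑<-cong A (λ n n<A → T′≈-U n n<A)) T′A≈0)) ⟩
    ∑< (suc A) T + (S₀ + (∑[ n < A ] - U (suc n) + 0#))
      ≈⟨ +-congˡ (+-cong (-‿distribˡ-*³ _ _ _) (trans (+-identityʳ _) (∑<-neg A (U ∘ suc)))) ⟩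
    ∑< (suc A) T + (- U 0 + - (∑[ n < A ] U (suc n)))
      ≈⟨ +-congˡ (-‿+-comm _ _) ⟩
    ∑< (suc A) T + - (U 0 + ∑[ n < A ] U (suc n))
      ≡⟨ ≡.cong (λ x → ∑< (suc A) T + - x) (∑<-suc A U) ⟨
    ∑< (suc A) T + - ∑< (suc A) U ∎
    where
    S₀ = - sign A * binomᴿ A 0 * φ (suc A) 0
    T T′ U : ℕ → Carrier
    T  n = sign (A ∸ n) * binomᴿ A n * φ (A ∸ n) (suc n)
    T′ n = sign (A ∸ n) * binomᴿ A (suc n) * φ (A ∸ n) (suc n)
    U  n = sign (A ∸ n) * binomᴿ A n * φ (suc A ∸ n) n

    T′≈-U : ∀ n → n < A → T′ n ≈ - U (suc n)
    T′≈-U n n<A = trans (*-congʳ (*-congʳ (reflexive (sign-pred n<A)))) (-‿distribˡ-*³ _ _ _)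

    T′A≈0 : T′ A ≈ 0#
    T′A≈0 = trans (*-congʳ (trans (*-congˡ (binomᴿ-< (ℕ.n<1+n A))) (zeroʳ _))) (zeroˡ _)

  ∑-sign-binom-[≤] : ∀ A d k →
    ∑[ n < suc A ] sign (A ∸ n) * binomᴿ A n * ([ A ∸ n ≤ k ]· binomᴿ (d ℕ.+ n) (k ∸ (A ∸ n))) ≈ binomᴿ d k
  ∑-sign-binom-[≤] zero d k = begin
    1# * ofℕ 1 * binomᴿ (d ℕ.+ 0) k + 0#   ≈⟨ trans (+-identityʳ _) (trans (*-congʳ (*-identityˡ _)) (*-congʳ ofℕ-1)) ⟩
    1# * binomᴿ (d ℕ.+ 0) k                ≈⟨ *-identityˡ _ ⟩
    binomᴿ (d ℕ.+ 0) k                     ≡⟨ ≡.cong (λ n → binomᴿ n k) (ℕ.+-identityʳ d) ⟩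
    binomᴿ d k                             ∎
  ∑-sign-binom-[≤] (suc A) d k = begin
    ∑[ n < suc (suc A) ] sign (suc A ∸ n) * binomᴿ (suc A) n * φ d k (suc A ∸ n) n
      ≈⟨ ∑-sign-binom-pascal A (φ d k) ⟩
    ∑[ n < suc A ] sign (A ∸ n) * binomᴿ A n * φ d k (A ∸ n) (suc n)
      + - (∑[ n < suc A ] sign (A ∸ n) * binomᴿ A n * φ d k (suc A ∸ n) n)
      ≈⟨ +-cong (∑<-cong (suc A) (λ n _ → reflexive (≡.cong (λ m → sign (A ∸ n) * binomᴿ A n * ([ A ∸ n ≤ k ]· binomᴿ m (k ∸ (A ∸ n))))
                                                            (ℕ.+-suc d n))))
                (-‿cong (∑<-cong (suc A) (λ n n<1+A → reflexive (≡.cong (λ c → sign (A ∸ n) * binomᴿ A n * φ d k c n)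
                                                                 (ℕ.+-∸-assoc 1 (ℕ.≤-pred n<1+A)))))) ⟩
    ∑[ n < suc A ] sign (A ∸ n) * binomᴿ A n * φ (suc d) k (A ∸ n) n
      + - (∑[ n < suc A ] sign (A ∸ n) * binomᴿ A n * φ d k (suc (A ∸ n)) n)
      ≈⟨ +-cong (∑-sign-binom-[≤] A (suc d) k) (-‿cong (carry k)) ⟩
    binomᴿ (suc d) k + - lower k
      ≈⟨ pascal k ⟩
    binomᴿ d k ∎
    where
    φ : ℕ → ℕ → ℕ → ℕ → Carrier
    φ d k c n = [ c ≤ k ]· binomᴿ (d ℕ.+ n) (k ∸ c)

    lower : ℕ → Carrier
    lower zero    = 0#
    lower (suc k) = binomᴿ d k

    carry : ∀ k → ∑[ n < suc A ] sign (A ∸ n) * binomᴿ A n * φ d k (suc (A ∸ n)) n ≈ lower k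
    carry zero    = ∑<-zero (suc A) (λ _ _ → zeroʳ _)
    carry (suc k) = ∑-sign-binom-[≤] A d k

    pascal : ∀ k → binomᴿ (suc d) k + - lower k ≈ binomᴿ d k
    pascal zero    = trans (+-congˡ -0#≈0#) (+-identityʳ _)
    pascal (suc k) = begin
      binomᴿ (suc d) (suc k) + - binomᴿ d k           ≈⟨ +-congʳ (binomᴿ-pascal d k) ⟩
      binomᴿ d k + binomᴿ d (suc k) + - binomᴿ d k    ≈⟨ trans (+-congʳ (+-comm _ _)) (+-assoc _ _ _) ⟩
      binomᴿ d (suc k) + (binomᴿ d k + - binomᴿ d k)  ≈⟨ trans (+-congˡ (-‿inverseʳ _)) (+-identityʳ _) ⟩
      binomᴿ d (suc k)                                ∎

  δℕ : ℕ → ℕ → Carrier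
  δℕ zero    zero    = 1#
  δℕ zero    (suc n) = 0#
  δℕ (suc m) zero    = 0#
  δℕ (suc m) (suc n) = δℕ m n

  δℕ-refl : ∀ m → δℕ m m ≡ 1#
  δℕ-refl zero    = ≡.refl
  δℕ-refl (suc m) = δℕ-refl m

  δ : Word → Word → Carrier
  δ []      []      = 1#
  δ []      (_ ∷ _) = 0#
  δ (_ ∷ _) []      = 0#
  δ (X ∷ u) (X ∷ w) = δ u w
  δ (Y ∷ u) (Y ∷ w) = δ u w
  δ (X ∷ u) (Y ∷ w) = 0#
  δ (Y ∷ u) (X ∷ w) = 0#

  δ-refl : ∀ u → δ u u ≡ 1#
  δ-refl []      = ≡.refl
  δ-refl (X ∷ u) = δ-refl u
  δ-refl (Y ∷ u) = δ-refl u

  δ-≢ : ∀ {u w} → u ≢ w → δ u w ≡ 0#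
  δ-≢ {[]}    {[]}    u≢w = contradiction ≡.refl u≢w
  δ-≢ {[]}    {_ ∷ _} u≢w = ≡.refl
  δ-≢ {_ ∷ _} {[]}    u≢w = ≡.refl
  δ-≢ {X ∷ u} {X ∷ w} u≢w = δ-≢ (u≢w ∘ ≡.cong (X ∷_))
  δ-≢ {Y ∷ u} {Y ∷ w} u≢w = δ-≢ (u≢w ∘ ≡.cong (Y ∷_))
  δ-≢ {X ∷ u} {Y ∷ w} u≢w = ≡.refl
  δ-≢ {Y ∷ u} {X ∷ w} u≢w = ≡.refl

  δ-∷ʳ : ∀ u w a → δ (u ∷ʳ a) (w ∷ʳ a) ≡ δ u w
  δ-∷ʳ u w a with u ≟W w
  ... | yes ≡.refl = ≡.trans (δ-refl (u ∷ʳ a)) (≡.sym (δ-refl u))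
  ... | no  u≢w    = ≡.trans (δ-≢ (u≢w ∘ List.∷ʳ-injectiveˡ u w)) (≡.sym (δ-≢ u≢w))

  δ-∷ʳ-≢ : ∀ u w {a b} → a ≢ b → δ (u ∷ʳ a) (w ∷ʳ b) ≡ 0#
  δ-∷ʳ-≢ u w a≢b = δ-≢ (a≢b ∘ List.∷ʳ-injectiveʳ u w)

  δ[]-∷ʳ : ∀ w a → δ [] (w ∷ʳ a) ≡ 0#
  δ[]-∷ʳ []      a = ≡.refl
  δ[]-∷ʳ (_ ∷ _) a = ≡.refl

  coeff : Poly → Word → Carrier
  coeff P w = ∑ P (λ (a , u) → a * δ u w)

  ⟨,word⟩≈coeff : ∀ P w → ⟨ P , word w ⟩ ≈ coeff P w
  ⟨,word⟩≈coeff []            w = refl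
  ⟨,word⟩≈coeff ((a , u) ∷ P) w with u ≟W w
  ... | yes ≡.refl = +-cong (*-congˡ (reflexive (≡.sym (δ-refl u)))) (⟨,word⟩≈coeff P w)
  ... | no  u≢w    = +-cong (trans (sym (zeroʳ a)) (*-congˡ (reflexive (≡.sym (δ-≢ u≢w))))) (⟨,word⟩≈coeff P w)

  ∑-⊗ : ∀ P Q (f : Carrier × Word → Carrier) →
        ∑ (P ⊗ Q) f ≈ ∑ P (λ (a , u) → ∑ Q (λ (b , v) → f (a * b , u ++ v)))
  ∑-⊗ P Q f = trans (∑-concatMap P _ f) (∑-cong P (λ _ → reflexive (∑-map Q _ f)))

  coeff-++ : ∀ P Q w → coeff (P ++ Q) w ≈ coeff P w + coeff Q w
  coeff-++ P Q w = ∑-++ P Q _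

  coeff-⊗-assoc : ∀ P Q N w → coeff ((P ⊗ Q) ⊗ N) w ≈ coeff (P ⊗ (Q ⊗ N)) w
  coeff-⊗-assoc P Q N w = begin
    coeff ((P ⊗ Q) ⊗ N) w
      ≈⟨ ∑-⊗ (P ⊗ Q) N _ ⟩
    ∑ (P ⊗ Q) (λ (a , u) → ∑ N (λ (c , x) → a * c * δ (u ++ x) w))
      ≈⟨ ∑-⊗ P Q _ ⟩
    ∑ P (λ (a , u) → ∑ Q (λ (b , v) → ∑ N (λ (c , x) → a * b * c * δ ((u ++ v) ++ x) w)))
      ≈⟨ ∑-cong P (λ (a , u) → ∑-cong Q (λ (b , v) → ∑-cong N (λ (c , x) →
           *-cong (*-assoc a b c) (reflexive (≡.cong (λ z → δ z w) (List.++-assoc u v x)))))) ⟩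
    ∑ P (λ (a , u) → ∑ Q (λ (b , v) → ∑ N (λ (c , x) → a * (b * c) * δ (u ++ v ++ x) w)))
      ≈⟨ ∑-cong P (λ (a , u) → ∑-⊗ Q N _) ⟨
    ∑ P (λ (a , u) → ∑ (Q ⊗ N) (λ (b , v) → a * b * δ (u ++ v) w))
      ≈⟨ ∑-⊗ P (Q ⊗ N) _ ⟨
    coeff (P ⊗ (Q ⊗ N)) w ∎

  coeff-⊖⊗ : ∀ P N w → coeff ((⊖ P) ⊗ N) w ≈ - coeff (P ⊗ N) w
  coeff-⊖⊗ P N w = begin
    coeff ((⊖ P) ⊗ N) w
      ≈⟨ ∑-⊗ (⊖ P) N _ ⟩
    ∑ (⊖ P) (λ (a , u) → ∑ N (λ (b , v) → a * b * δ (u ++ v) w))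
      ≡⟨ ∑-map P _ _ ⟩
    ∑ P (λ (a , u) → ∑ N (λ (b , v) → - a * b * δ (u ++ v) w))
      ≈⟨ ∑-cong P (λ (a , u) → ∑-cong N (λ (b , v) → -‿distribˡ-*³ a b (δ (u ++ v) w))) ⟩
    ∑ P (λ (a , u) → ∑ N (λ (b , v) → - (a * b * δ (u ++ v) w)))
      ≈⟨ ∑-cong P (λ (a , u) → ∑-neg N _) ⟩
    ∑ P (λ (a , u) → - ∑ N (λ (b , v) → a * b * δ (u ++ v) w))
      ≈⟨ ∑-neg P _ ⟩
    - ∑ P (λ (a , u) → ∑ N (λ (b , v) → a * b * δ (u ++ v) w))
      ≈⟨ -‿cong (∑-⊗ P N _) ⟨
    - coeff (P ⊗ N) w ∎

  coeff-Yder-suc⊗ : ∀ t N w → coeff (Yder (suc t) ⊗ N) w ≈ coeff (Xp ⊗ (Yder t ⊗ N)) w + - coeff (Yder t ⊗ (Xp ⊗ N)) w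
  coeff-Yder-suc⊗ t N w = begin
    coeff ((Xp ⊗ Yder t ++ ⊖ (Yder t ⊗ Xp)) ⊗ N) w
      ≡⟨ ≡.cong (λ P → coeff P w) (List.concatMap-++ _ (Xp ⊗ Yder t) (⊖ (Yder t ⊗ Xp))) ⟩
    coeff ((Xp ⊗ Yder t) ⊗ N ++ (⊖ (Yder t ⊗ Xp)) ⊗ N) w
      ≈⟨ coeff-++ ((Xp ⊗ Yder t) ⊗ N) _ w ⟩
    coeff ((Xp ⊗ Yder t) ⊗ N) w + coeff ((⊖ (Yder t ⊗ Xp)) ⊗ N) w
      ≈⟨ +-cong (coeff-⊗-assoc Xp (Yder t) N w)
                (trans (coeff-⊖⊗ (Yder t ⊗ Xp) N w) (-‿cong (coeff-⊗-assoc (Yder t) Xp N w))) ⟩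
    coeff (Xp ⊗ (Yder t ⊗ N)) w + - coeff (Yder t ⊗ (Xp ⊗ N)) w ∎

  -- coeffXs j N r is the coefficient of X^j N at r
  coeffXs : ℕ → Poly → Word → Carrier
  coeffXs zero    N r       = coeff N r
  coeffXs (suc j) N []      = 0#
  coeffXs (suc j) N (X ∷ r) = coeffXs j N r
  coeffXs (suc j) N (Y ∷ r) = 0#

  coeff-Xp⊗ : ∀ N r → coeff (Xp ⊗ N) r ≈ coeffXs 1 N r
  coeff-Xp⊗ N r = trans (∑-⊗ Xp N _) (trans (+-identityʳ _) (strip r))
    where
    strip : ∀ r → ∑ N (λ (b , v) → 1# * b * δ (X ∷ v) r) ≈ coeffXs 1 N r
    strip []      = ∑-zero N (λ _ → zeroʳ _)
    strip (X ∷ r) = ∑-cong N (λ (b , v) → *-congʳ (*-identityˡ b))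
    strip (Y ∷ r) = ∑-zero N (λ _ → zeroʳ _)

  coeffXs-Xp⊗ : ∀ j N r → coeffXs j (Xp ⊗ N) r ≈ coeffXs (suc j) N r
  coeffXs-Xp⊗ zero    N r       = coeff-Xp⊗ N r
  coeffXs-Xp⊗ (suc j) N []      = refl
  coeffXs-Xp⊗ (suc j) N (X ∷ r) = coeffXs-Xp⊗ j N r
  coeffXs-Xp⊗ (suc j) N (Y ∷ r) = refl

  coeff-⊗Yp-∷ʳY : ∀ Q w → coeff (Q ⊗ Yp) (w ∷ʳ Y) ≈ coeff Q w
  coeff-⊗Yp-∷ʳY Q w = trans (∑-⊗ Q Yp _) (∑-cong Q (λ (a , u) →
    trans (+-identityʳ _) (*-cong (*-identityʳ a) (reflexive (δ-∷ʳ u w Y)))))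

  coeff-⊗Yp-∷ʳX : ∀ Q w → coeff (Q ⊗ Yp) (w ∷ʳ X) ≈ 0#
  coeff-⊗Yp-∷ʳX Q w = trans (∑-⊗ Q Yp _) (∑-zero Q (λ (a , u) →
    trans (+-identityʳ _) (trans (*-congˡ (reflexive (δ-∷ʳ-≢ u w λ ()))) (zeroʳ _))))

  -- The pairing with M^(τ;0)

  coeff-Yder⊗ : ∀ t N i r → coeff (Yder t ⊗ N) (Xw i ++ Y ∷ r) ≈ sign (t ∸ i) * binomᴿ t i * coeffXs (t ∸ i) N r
  coeff-Yder⊗ zero N zero r = begin
    coeff (Yp ⊗ N) (Y ∷ r)                            ≈⟨ ∑-⊗ Yp N _ ⟩
    ∑ N (λ (b , v) → 1# * b * δ (Y ∷ v) (Y ∷ r)) + 0# ≈⟨ +-identityʳ _ ⟩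
    ∑ N (λ (b , v) → 1# * b * δ v r)                  ≈⟨ ∑-cong N (λ (b , v) → *-congʳ (*-identityˡ b)) ⟩
    coeff N r                                         ≈⟨ *-identityˡ _ ⟨
    1# * coeff N r                                    ≈⟨ *-congʳ (trans (*-identityˡ _) ofℕ-1) ⟨
    1# * ofℕ 1 * coeff N r                            ∎
  coeff-Yder⊗ zero N (suc i) r = begin
    coeff (Yp ⊗ N) (X ∷ Xw i ++ Y ∷ r)                            ≈⟨ ∑-⊗ Yp N _ ⟩
    ∑ N (λ (b , v) → 1# * b * δ (Y ∷ v) (X ∷ Xw i ++ Y ∷ r)) + 0# ≈⟨ +-identityʳ _ ⟩
    ∑ N (λ (b , v) → 1# * b * 0#)                                 ≈⟨ ∑-zero N (λ _ → zeroʳ _) ⟩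
    0#                                                            ≈⟨ zeroˡ _ ⟨
    0# * coeffXs 0 N r                                            ≈⟨ *-congʳ (zeroʳ _) ⟨
    1# * 0# * coeffXs 0 N r                                       ∎
  coeff-Yder⊗ (suc t) N zero r = begin
    coeff (Yder (suc t) ⊗ N) (Y ∷ r)
      ≈⟨ coeff-Yder-suc⊗ t N (Y ∷ r) ⟩
    coeff (Xp ⊗ (Yder t ⊗ N)) (Y ∷ r) + - coeff (Yder t ⊗ (Xp ⊗ N)) (Y ∷ r)
      ≈⟨ +-cong (coeff-Xp⊗ (Yder t ⊗ N) (Y ∷ r)) (-‿cong (coeff-Yder⊗ t (Xp ⊗ N) zero r)) ⟩
    0# + - (sign t * binomᴿ t 0 * coeffXs t (Xp ⊗ N) r)
      ≈⟨ +-identityˡ _ ⟩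
    - (sign t * binomᴿ t 0 * coeffXs t (Xp ⊗ N) r)
      ≈⟨ -‿cong (*-congˡ (coeffXs-Xp⊗ t N r)) ⟩
    - (sign t * binomᴿ t 0 * coeffXs (suc t) N r)
      ≈⟨ trans (-‿distribˡ-* _ _) (*-congʳ (-‿distribˡ-* _ _)) ⟩
    - sign t * binomᴿ t 0 * coeffXs (suc t) N r ∎
  coeff-Yder⊗ (suc t) N (suc i) r = begin
    coeff (Yder (suc t) ⊗ N) (X ∷ Xw i ++ Y ∷ r)
      ≈⟨ coeff-Yder-suc⊗ t N _ ⟩
    coeff (Xp ⊗ (Yder t ⊗ N)) (X ∷ Xw i ++ Y ∷ r) + - coeff (Yder t ⊗ (Xp ⊗ N)) (X ∷ Xw i ++ Y ∷ r)
      ≈⟨ +-cong (trans (coeff-Xp⊗ (Yder t ⊗ N) _) (coeff-Yder⊗ t N i r))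
                (-‿cong (trans (coeff-Yder⊗ t (Xp ⊗ N) (suc i) r) (*-congˡ (coeffXs-Xp⊗ (t ∸ suc i) N r)))) ⟩
    sign (t ∸ i) * binomᴿ t i * coeffXs (t ∸ i) N r
      + - (sign (t ∸ suc i) * binomᴿ t (suc i) * coeffXs (suc (t ∸ suc i)) N r)
      ≈⟨ pascal (i ℕ.<? t) ⟩
    sign (t ∸ i) * (binomᴿ t i + binomᴿ t (suc i)) * coeffXs (t ∸ i) N r
      ≈⟨ *-congʳ (*-congˡ (binomᴿ-pascal t i)) ⟨
    sign (t ∸ i) * binomᴿ (suc t) (suc i) * coeffXs (t ∸ i) N r ∎
    where
    pascal : Dec (i < t) →
      sign (t ∸ i) * binomᴿ t i * coeffXs (t ∸ i) N r
        + - (sign (t ∸ suc i) * binomᴿ t (suc i) * coeffXs (suc (t ∸ suc i)) N r)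
      ≈ sign (t ∸ i) * (binomᴿ t i + binomᴿ t (suc i)) * coeffXs (t ∸ i) N r
    pascal (yes i<t) rewrite m∸n≡1+[m∸1+n] t i i<t = begin
      - s * x * z + - (s * y * z)   ≈⟨ +-congˡ (trans (-‿distribˡ-* _ _) (*-congʳ (-‿distribˡ-* s y))) ⟩
      - s * x * z + - s * y * z     ≈⟨ solve 4 (λ s x y z → s :* x :* z :+ s :* y :* z := s :* (x :+ y) :* z) refl (- s) x y z ⟩
      - s * (x + y) * z             ∎
      where
      s = sign (t ∸ suc i)
      x = binomᴿ t i
      y = binomᴿ t (suc i)
      z = coeffXs (suc (t ∸ suc i)) N r
    pascal (no i≮t) = begin
      x + - (s * y * z)   ≈⟨ +-congˡ (trans (-‿cong (trans (*-congʳ (*-congˡ y≈0)) (trans (*-congʳ (zeroʳ s)) (zeroˡ z))))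
                                              -0#≈0#) ⟩
      x + 0#              ≈⟨ +-identityʳ x ⟩
      x                   ≈⟨ *-congʳ (*-congˡ (trans (+-congˡ y≈0) (+-identityʳ _))) ⟨
      sign (t ∸ i) * (binomᴿ t i + y) * coeffXs (t ∸ i) N r ∎
      where
      x = sign (t ∸ i) * binomᴿ t i * coeffXs (t ∸ i) N r
      s = sign (t ∸ suc i)
      y = binomᴿ t (suc i)
      z = coeffXs (suc (t ∸ suc i)) N r
      y≈0 : y ≈ 0#
      y≈0 = binomᴿ-< (s≤s (ℕ.≮⇒≥ i≮t))

  wVec : ∀ {n} → Vec ℕ n → ℕ → Word
  wVec κ m = wWord (toList κ) m

  coeffXs-Xw++Y∷ : ∀ c k N r → coeffXs c N (Xw k ++ Y ∷ r) ≡ [ c ≤ k ]· coeff N (Xw (k ∸ c) ++ Y ∷ r)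
  coeffXs-Xw++Y∷ zero    k       N r = ≡.refl
  coeffXs-Xw++Y∷ (suc c) zero    N r = ≡.refl
  coeffXs-Xw++Y∷ (suc c) (suc k) N r = coeffXs-Xw++Y∷ c k N r

  -- The coefficient of M(τ) at w(κ; ·) once c letters X of the first block are used up:
  -- each factor Y^(t) takes k ∸ c letters X before its Y and leaves a carry t ∸ (k ∸ c) for
  -- the next block; g weighs the final carry.
  Mweight : ∀ {n} → ℕ → Vec ℕ n → Vec ℕ n → (ℕ → Carrier) → Carrier
  Mweight c []      []      g = g c
  Mweight c (t ∷ τ) (k ∷ κ) g =
    [ c ≤ k ]· (sign (t ∸ (k ∸ c)) * binomᴿ t (k ∸ c) * Mweight (t ∸ (k ∸ c)) τ κ g)

  coeffXs-word[] : ∀ c m → coeffXs c (word []) (Xw m) ≈ δℕ c m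
  coeffXs-word[] zero    zero    = trans (+-identityʳ _) (*-identityʳ _)
  coeffXs-word[] zero    (suc m) = trans (+-identityʳ _) (zeroʳ _)
  coeffXs-word[] (suc c) zero    = refl
  coeffXs-word[] (suc c) (suc m) = coeffXs-word[] c m

  coeffXs-M : ∀ {n} c (τ κ : Vec ℕ n) m → coeffXs c (M (toList τ) 0) (wVec κ m) ≈ Mweight c τ κ (λ c′ → δℕ c′ m)
  coeffXs-M c []      []      m = coeffXs-word[] c m
  coeffXs-M c (t ∷ τ) (k ∷ κ) m = begin
    coeffXs c (Yder t ⊗ M (toList τ) 0) (wVec (k ∷ κ) m)
      ≡⟨ ≡.trans (≡.cong (coeffXs c _) (wWord-∷ k (toList κ) m)) (coeffXs-Xw++Y∷ c k _ _) ⟩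
    [ c ≤ k ]· coeff (Yder t ⊗ M (toList τ) 0) (Xw (k ∸ c) ++ Y ∷ wVec κ m)
      ≈⟨ [≤]·-cong c k (trans (coeff-Yder⊗ t _ (k ∸ c) _) (*-congˡ (coeffXs-M _ τ κ m))) ⟩
    Mweight c (t ∷ τ) (k ∷ κ) (λ c′ → δℕ c′ m) ∎

  ⟨M,word⟩≈Mweight : ∀ {n} (τ κ : Vec ℕ n) m →
                     ⟨ M (toList τ) 0 , word (wVec κ m) ⟩ ≈ Mweight 0 τ κ (λ c′ → δℕ c′ m)
  ⟨M,word⟩≈Mweight τ κ m = trans (⟨,word⟩≈coeff (M (toList τ) 0) (wVec κ m)) (coeffXs-M 0 τ κ m)

  Mweight-∷ʳ : ∀ {n} c (τ κ : Vec ℕ n) t k g →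
               Mweight c (τ Vec.∷ʳ t) (κ Vec.∷ʳ k) g ≡ Mweight c τ κ (λ c′ → Mweight c′ (t ∷ []) (k ∷ []) g)
  Mweight-∷ʳ c []        []        t k g = ≡.refl
  Mweight-∷ʳ c (t₀ ∷ τ) (k₀ ∷ κ) t k g =
    ≡.cong (λ x → [ c ≤ k₀ ]· (sign (t₀ ∸ (k₀ ∸ c)) * binomᴿ t₀ (k₀ ∸ c) * x)) (Mweight-∷ʳ _ τ κ t k g)

  Mweight-single : ∀ {A n} d k g → n ≤ A →
    Mweight (A ∸ n) ((d ℕ.+ n) ∷ []) (k ∷ []) g
    ≈ ([ A ∸ n ≤ k ]· binomᴿ (d ℕ.+ n) (k ∸ (A ∸ n))) * (sign (A ℕ.+ d ∸ k) * g (A ℕ.+ d ∸ k))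
  Mweight-single {A} {n} d k g n≤A with (A ∸ n) ℕ.≤? k
  ... | yes c≤k rewrite [≤]·-yes (sign (d ℕ.+ n ∸ (k ∸ (A ∸ n))) * binomᴿ (d ℕ.+ n) (k ∸ (A ∸ n))
                                   * g (d ℕ.+ n ∸ (k ∸ (A ∸ n)))) c≤k
                      | [≤]·-yes (binomᴿ (d ℕ.+ n) (k ∸ (A ∸ n))) c≤k
                      | ∸-∸-shift d n≤A c≤k =
    solve 3 (λ s b x → s :* b :* x := b :* (s :* x)) refl _ _ _
  ... | no  c≰k rewrite [≤]·-no (sign (d ℕ.+ n ∸ (k ∸ (A ∸ n))) * binomᴿ (d ℕ.+ n) (k ∸ (A ∸ n))
                                 * g (d ℕ.+ n ∸ (k ∸ (A ∸ n)))) (ℕ.≰⇒> c≰k)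
                      | [≤]·-no (binomᴿ (d ℕ.+ n) (k ∸ (A ∸ n))) (ℕ.≰⇒> c≰k) =
    sym (zeroˡ _)

  -- Deleting letters X

  -- all ways, with multiplicity, of deleting t letters X from a word
  deleteXs : ℕ → Word → List Word
  deleteXs zero    w       = w ∷ []
  deleteXs (suc t) []      = []
  deleteXs (suc t) (X ∷ w) = map (X ∷_) (deleteXs (suc t) w) ++ deleteXs t w
  deleteXs (suc t) (Y ∷ w) = map (Y ∷_) (deleteXs (suc t) w)

  ∑-map-∷ : ∀ a ws (f : Word → Carrier) → ∑ (map (a ∷_) ws) f ≡ ∑[ w ∈ ws ] f (a ∷ w)
  ∑-map-∷ a ws f = ∑-map ws (a ∷_) f

  ∑-deleteXs-δ[] : ∀ t w → ∑[ u ∈ deleteXs t w ] δ [] u ≈ δ (Xw t) w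
  ∑-deleteXs-δ[] zero    w       = +-identityʳ _
  ∑-deleteXs-δ[] (suc t) []      = refl
  ∑-deleteXs-δ[] (suc t) (X ∷ w) = begin
    ∑ (map (X ∷_) (deleteXs (suc t) w) ++ deleteXs t w) (δ [])
      ≈⟨ ∑-++ (map (X ∷_) (deleteXs (suc t) w)) _ _ ⟩
    ∑ (map (X ∷_) (deleteXs (suc t) w)) (δ []) + ∑ (deleteXs t w) (δ [])
      ≈⟨ +-cong (trans (reflexive (∑-map-∷ X (deleteXs (suc t) w) (δ []))) (∑-zero (deleteXs (suc t) w) (λ _ → refl)))
                (∑-deleteXs-δ[] t w) ⟩
    0# + δ (Xw t) w
      ≈⟨ +-identityˡ _ ⟩
    δ (Xw t) w ∎
  ∑-deleteXs-δ[] (suc t) (Y ∷ w) =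
    trans (reflexive (∑-map-∷ Y (deleteXs (suc t) w) (δ []))) (∑-zero (deleteXs (suc t) w) (λ _ → refl))

  ∑-shuffle-δ≈∑-deleteXs-δ : ∀ u t w → ∑[ v ∈ shuffleW u (Xw t) ] δ v w ≈ ∑[ v ∈ deleteXs t w ] δ u v
  ∑-shuffle-δ≈∑-deleteXs-δ []      zero    w = refl
  ∑-shuffle-δ≈∑-deleteXs-δ (a ∷ u) zero    w = refl
  ∑-shuffle-δ≈∑-deleteXs-δ []      (suc t) w = trans (+-identityʳ _) (sym (∑-deleteXs-δ[] (suc t) w))
  ∑-shuffle-δ≈∑-deleteXs-δ (a ∷ u) (suc t) w = begin
    ∑ (map (a ∷_) (shuffleW u (Xw (suc t))) ++ map (X ∷_) (shuffleW (a ∷ u) (Xw t))) (λ v → δ v w)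
      ≈⟨ ∑-++ (map (a ∷_) (shuffleW u (Xw (suc t)))) _ _ ⟩
    ∑ (map (a ∷_) (shuffleW u (Xw (suc t)))) (λ v → δ v w) + ∑ (map (X ∷_) (shuffleW (a ∷ u) (Xw t))) (λ v → δ v w)
      ≡⟨ ≡.cong₂ _+_ (∑-map-∷ a (shuffleW u (Xw (suc t))) (λ v → δ v w))
                     (∑-map-∷ X (shuffleW (a ∷ u) (Xw t)) (λ v → δ v w)) ⟩
    ∑[ v ∈ shuffleW u (Xw (suc t)) ] δ (a ∷ v) w + ∑[ v ∈ shuffleW (a ∷ u) (Xw t) ] δ (X ∷ v) w
      ≈⟨ split a w ⟩
    ∑[ v ∈ deleteXs (suc t) w ] δ (a ∷ u) v ∎
    where
    none : ∀ ws {f : Word → Carrier} → (∀ v → f v ≡ 0#) → ∑ ws f ≈ 0#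
    none ws f≡0 = ∑-zero ws (reflexive ∘ f≡0)

    split : ∀ a w → ∑[ v ∈ shuffleW u (Xw (suc t)) ] δ (a ∷ v) w + ∑[ v ∈ shuffleW (a ∷ u) (Xw t) ] δ (X ∷ v) w
                  ≈ ∑[ v ∈ deleteXs (suc t) w ] δ (a ∷ u) v
    split a []      = trans (+-cong (none (shuffleW u (Xw (suc t))) (λ _ → ≡.refl))
                                    (none (shuffleW (a ∷ u) (Xw t)) (λ _ → ≡.refl)))
                            (+-identityʳ 0#)
    split X (X ∷ w) = begin
      ∑[ v ∈ shuffleW u (Xw (suc t)) ] δ v w + ∑[ v ∈ shuffleW (X ∷ u) (Xw t) ] δ v w
        ≈⟨ +-cong (∑-shuffle-δ≈∑-deleteXs-δ u (suc t) w) (∑-shuffle-δ≈∑-deleteXs-δ (X ∷ u) t w) ⟩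
      ∑[ v ∈ deleteXs (suc t) w ] δ u v + ∑[ v ∈ deleteXs t w ] δ (X ∷ u) v
        ≡⟨ ≡.cong (_+ ∑ (deleteXs t w) (δ (X ∷ u))) (∑-map-∷ X (deleteXs (suc t) w) (δ (X ∷ u))) ⟨
      ∑ (map (X ∷_) (deleteXs (suc t) w)) (δ (X ∷ u)) + ∑ (deleteXs t w) (δ (X ∷ u))
        ≈⟨ ∑-++ (map (X ∷_) (deleteXs (suc t) w)) _ _ ⟨
      ∑ (deleteXs (suc t) (X ∷ w)) (δ (X ∷ u)) ∎
    split X (Y ∷ w) = begin
      ∑[ v ∈ shuffleW u (Xw (suc t)) ] δ (X ∷ v) (Y ∷ w) + ∑[ v ∈ shuffleW (X ∷ u) (Xw t) ] δ (X ∷ v) (Y ∷ w)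
        ≈⟨ +-cong (none (shuffleW u (Xw (suc t))) (λ _ → ≡.refl)) (none (shuffleW (X ∷ u) (Xw t)) (λ _ → ≡.refl)) ⟩
      0# + 0#
        ≈⟨ +-identityʳ 0# ⟩
      0#
        ≈⟨ trans (reflexive (∑-map-∷ Y (deleteXs (suc t) w) (δ (X ∷ u)))) (none (deleteXs (suc t) w) (λ _ → ≡.refl)) ⟨
      ∑ (deleteXs (suc t) (Y ∷ w)) (δ (X ∷ u)) ∎
    split Y (X ∷ w) = begin
      ∑[ v ∈ shuffleW u (Xw (suc t)) ] δ (Y ∷ v) (X ∷ w) + ∑[ v ∈ shuffleW (Y ∷ u) (Xw t) ] δ v w
        ≈⟨ +-cong (none (shuffleW u (Xw (suc t))) (λ _ → ≡.refl)) (∑-shuffle-δ≈∑-deleteXs-δ (Y ∷ u) t w) ⟩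
      0# + ∑[ v ∈ deleteXs t w ] δ (Y ∷ u) v
        ≈⟨ +-congʳ (trans (reflexive (∑-map-∷ X (deleteXs (suc t) w) (δ (Y ∷ u)))) (none (deleteXs (suc t) w) (λ _ → ≡.refl))) ⟨
      ∑ (map (X ∷_) (deleteXs (suc t) w)) (δ (Y ∷ u)) + ∑ (deleteXs t w) (δ (Y ∷ u))
        ≈⟨ ∑-++ (map (X ∷_) (deleteXs (suc t) w)) _ _ ⟨
      ∑ (deleteXs (suc t) (X ∷ w)) (δ (Y ∷ u)) ∎
    split Y (Y ∷ w) = begin
      ∑[ v ∈ shuffleW u (Xw (suc t)) ] δ v w + ∑[ v ∈ shuffleW (Y ∷ u) (Xw t) ] δ (X ∷ v) (Y ∷ w)
        ≈⟨ +-cong (∑-shuffle-δ≈∑-deleteXs-δ u (suc t) w) (none (shuffleW (Y ∷ u) (Xw t)) (λ _ → ≡.refl)) ⟩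
      ∑[ v ∈ deleteXs (suc t) w ] δ u v + 0#
        ≈⟨ +-identityʳ _ ⟩
      ∑[ v ∈ deleteXs (suc t) w ] δ u v
        ≡⟨ ∑-map-∷ Y (deleteXs (suc t) w) (δ (Y ∷ u)) ⟨
      ∑ (deleteXs (suc t) (Y ∷ w)) (δ (Y ∷ u)) ∎

  ∑-ш : ∀ P Q (f : Carrier × Word → Carrier) →
        ∑ (P ш Q) f ≈ ∑ P (λ (a , u) → ∑ Q (λ (b , v) → ∑[ w ∈ shuffleW u v ] f (a * b , w)))
  ∑-ш P Q f = trans (∑-concatMap P _ f) (∑-cong P (λ x →
    trans (∑-concatMap Q _ f) (∑-cong Q (λ (b , v) → reflexive (∑-map (shuffleW (proj₂ x) v) _ f)))))

  coeff-шXpow : ∀ Q t w → coeff (Q ш Xpow t) w ≈ ∑[ u ∈ deleteXs t w ] coeff Q u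
  coeff-шXpow Q t w = begin
    coeff (Q ш Xpow t) w
      ≈⟨ ∑-ш Q (Xpow t) _ ⟩
    ∑ Q (λ (a , u) → ∑[ v ∈ shuffleW u (Xw t) ] a * 1# * δ v w + 0#)
      ≈⟨ ∑-cong Q (λ _ → +-identityʳ _) ⟩
    ∑ Q (λ { (a , u) → ∑[ v ∈ shuffleW u (Xw t) ] a * 1# * δ v w })
      ≈⟨ ∑-cong Q (λ (a , u) → begin
           ∑[ v ∈ shuffleW u (Xw t) ] a * 1# * δ v w   ≈⟨ ∑-cong (shuffleW u (Xw t)) (λ v → *-congʳ (*-identityʳ a)) ⟩
           ∑[ v ∈ shuffleW u (Xw t) ] a * δ v w        ≈⟨ ∑-*ˡ (shuffleW u (Xw t)) a _ ⟩
           a * (∑[ v ∈ shuffleW u (Xw t) ] δ v w)      ≈⟨ *-congˡ (∑-shuffle-δ≈∑-deleteXs-δ u t w) ⟩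
           a * (∑[ v ∈ deleteXs t w ] δ u v)           ≈⟨ ∑-*ˡ (deleteXs t w) a _ ⟨
           ∑[ v ∈ deleteXs t w ] a * δ u v             ∎) ⟩
    ∑ Q (λ { (a , u) → ∑[ v ∈ deleteXs t w ] a * δ u v })
      ≈⟨ ∑-comm Q (deleteXs t w) _ ⟩
    ∑[ v ∈ deleteXs t w ] coeff Q v ∎

  binomᴿ-*-X∷Xw : ∀ a e (F : Word → Carrier) → binomᴿ a e * F (X ∷ Xw (a ∸ e)) ≈ binomᴿ a e * F (Xw (suc a ∸ e))
  binomᴿ-*-X∷Xw a e F = binomᴿ-*-congˡ a e (λ e≤a → reflexive (≡.cong (F ∘ Xw) (≡.sym (ℕ.+-∸-assoc 1 e≤a))))

  ∑-deleteXs-Xw : ∀ m t h → ∑ (deleteXs t (Xw m)) h ≈ binomᴿ m t * h (Xw (m ∸ t))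
  ∑-deleteXs-Xw m       zero    h = trans (+-identityʳ _) (sym (trans (*-congʳ ofℕ-1) (*-identityˡ _)))
  ∑-deleteXs-Xw zero    (suc t) h = sym (zeroˡ _)
  ∑-deleteXs-Xw (suc m) (suc t) h = begin
    ∑ (map (X ∷_) (deleteXs (suc t) (Xw m)) ++ deleteXs t (Xw m)) h
      ≈⟨ ∑-++ (map (X ∷_) (deleteXs (suc t) (Xw m))) _ h ⟩
    ∑ (map (X ∷_) (deleteXs (suc t) (Xw m))) h + ∑ (deleteXs t (Xw m)) h
      ≈⟨ +-cong (trans (reflexive (∑-map-∷ X (deleteXs (suc t) (Xw m)) h)) (∑-deleteXs-Xw m (suc t) (h ∘ (X ∷_))))
                (∑-deleteXs-Xw m t h) ⟩
    binomᴿ m (suc t) * h (X ∷ Xw (m ∸ suc t)) + binomᴿ m t * h (Xw (m ∸ t))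
      ≈⟨ +-congʳ (binomᴿ-*-X∷Xw m (suc t) h) ⟩
    binomᴿ m (suc t) * h (Xw (m ∸ t)) + binomᴿ m t * h (Xw (m ∸ t))
      ≈⟨ trans (+-comm _ _) (sym (distribʳ _ _ _)) ⟩
    (binomᴿ m t + binomᴿ m (suc t)) * h (Xw (m ∸ t))
      ≈⟨ *-congʳ (binomᴿ-pascal m t) ⟨
    binomᴿ (suc m) (suc t) * h (Xw (m ∸ t)) ∎

  ∑-deleteXs-Xw++ : ∀ a t r h →
    ∑ (deleteXs t (Xw a ++ r)) h ≈ ∑[ e < suc t ] binomᴿ a e * (∑[ u ∈ deleteXs (t ∸ e) r ] h (Xw (a ∸ e) ++ u))
  ∑-deleteXs-Xw++ zero    t       r h = sym (begin
    ∑[ e < suc t ] binomᴿ 0 e * (∑[ u ∈ deleteXs (t ∸ e) r ] h (Xw (0 ∸ e) ++ u))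
      ≡⟨ ∑<-suc t _ ⟩
    ofℕ 1 * ∑ (deleteXs t r) h + ∑[ e < t ] 0# * (∑[ u ∈ deleteXs (t ∸ suc e) r ] h u)
      ≈⟨ +-cong (trans (*-congʳ ofℕ-1) (*-identityˡ _)) (∑<-zero t (λ _ _ → zeroˡ _)) ⟩
    ∑ (deleteXs t r) h + 0#
      ≈⟨ +-identityʳ _ ⟩
    ∑ (deleteXs t r) h ∎)
  ∑-deleteXs-Xw++ (suc a) zero    r h = sym (trans (+-identityʳ _) (trans (*-congʳ ofℕ-1) (*-identityˡ _)))
  ∑-deleteXs-Xw++ (suc a) (suc t) r h = begin
    ∑ (map (X ∷_) (deleteXs (suc t) (Xw a ++ r)) ++ deleteXs t (Xw a ++ r)) h
      ≈⟨ ∑-++ (map (X ∷_) (deleteXs (suc t) (Xw a ++ r))) _ h ⟩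
    ∑ (map (X ∷_) (deleteXs (suc t) (Xw a ++ r))) h + ∑ (deleteXs t (Xw a ++ r)) h
      ≈⟨ +-cong (trans (reflexive (∑-map-∷ X (deleteXs (suc t) (Xw a ++ r)) h)) (∑-deleteXs-Xw++ a (suc t) r (h ∘ (X ∷_))))
                (∑-deleteXs-Xw++ a t r h) ⟩
    ∑[ e < suc (suc t) ] binomᴿ a e * (∑[ u ∈ deleteXs (suc t ∸ e) r ] h (X ∷ Xw (a ∸ e) ++ u))
      + ∑[ e < suc t ] binomᴿ a e * G (suc e)
      ≈⟨ +-congʳ (∑<-cong (suc (suc t)) (λ e _ → binomᴿ-*-X∷Xw a e (λ w → ∑[ u ∈ deleteXs (suc t ∸ e) r ] h (w ++ u)))) ⟩
    ∑[ e < suc (suc t) ] binomᴿ a e * G e + ∑[ e < suc t ] binomᴿ a e * G (suc e)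
      ≡⟨ ≡.cong (_+ ∑[ e < suc t ] binomᴿ a e * G (suc e)) (∑<-suc (suc t) _) ⟩
    (binomᴿ a 0 * G 0 + ∑[ e < suc t ] binomᴿ a (suc e) * G (suc e)) + ∑[ e < suc t ] binomᴿ a e * G (suc e)
      ≈⟨ trans (+-assoc _ _ _) (+-congˡ (+-comm _ _)) ⟩
    binomᴿ a 0 * G 0 + (∑[ e < suc t ] binomᴿ a e * G (suc e) + ∑[ e < suc t ] binomᴿ a (suc e) * G (suc e))
      ≈⟨ +-congˡ (∑<-+ (suc t) _ _) ⟨
    binomᴿ a 0 * G 0 + ∑[ e < suc t ] (binomᴿ a e * G (suc e) + binomᴿ a (suc e) * G (suc e))
      ≈⟨ +-congˡ (∑<-cong (suc t) (λ e _ → trans (sym (distribʳ _ _ _)) (*-congʳ (sym (binomᴿ-pascal a e))))) ⟩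
    binomᴿ (suc a) 0 * G 0 + ∑[ e < suc t ] binomᴿ (suc a) (suc e) * G (suc e)
      ≡⟨ ∑<-suc (suc t) _ ⟨
    ∑[ e < suc (suc t) ] binomᴿ (suc a) e * G e ∎
    where
    G : ℕ → Carrier
    G e = ∑[ u ∈ deleteXs (suc t ∸ e) r ] h (Xw (suc a ∸ e) ++ u)

  ∑-deleteXs-Y∷ : ∀ t w h → ∑ (deleteXs t (Y ∷ w)) h ≈ ∑[ u ∈ deleteXs t w ] h (Y ∷ u)
  ∑-deleteXs-Y∷ zero    w h = refl
  ∑-deleteXs-Y∷ (suc t) w h = reflexive (∑-map-∷ Y (deleteXs (suc t) w) h)

  -- deletionSum as m t H = ∑ ∏ᵢ C(aᵢ,eᵢ) · C(m,e) · H (a − e) (m − e) over e₁ + ⋯ + eₙ + e = t: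
  -- the deletions of t letters X from w(as; m), grouped by how many are taken from each block
  deletionSum : ∀ {n} → Vec ℕ n → ℕ → ℕ → (Vec ℕ n → ℕ → Carrier) → Carrier
  deletionSum []       m t H = binomᴿ m t * H [] (m ∸ t)
  deletionSum (a ∷ as) m t H = ∑[ e < suc t ] binomᴿ a e * deletionSum as m (t ∸ e) (λ bs m′ → H ((a ∸ e) ∷ bs) m′)

  deletionSum-cong≡ : ∀ {n} (as : Vec ℕ n) m t {H H′} → (∀ bs m′ → H bs m′ ≡ H′ bs m′) →
                      deletionSum as m t H ≈ deletionSum as m t H′
  deletionSum-cong≡ []       m t H≡H′ = *-congˡ (reflexive (H≡H′ [] _))
  deletionSum-cong≡ (a ∷ as) m t H≡H′ =
    ∑<-cong (suc t) (λ e _ → *-congˡ (deletionSum-cong≡ as m (t ∸ e) (λ bs → H≡H′ ((a ∸ e) ∷ bs))))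

  ∑-deleteXs-wVec : ∀ {n} (as : Vec ℕ n) m t h →
                    ∑ (deleteXs t (wVec as m)) h ≈ deletionSum as m t (λ bs m′ → h (wVec bs m′))
  ∑-deleteXs-wVec []       m t h = ∑-deleteXs-Xw m t h
  ∑-deleteXs-wVec (a ∷ as) m t h = begin
    ∑ (deleteXs t (wVec (a ∷ as) m)) h
      ≡⟨ ≡.cong (λ w → ∑ (deleteXs t w) h) (wWord-∷ a (toList as) m) ⟩
    ∑ (deleteXs t (Xw a ++ Y ∷ wVec as m)) h
      ≈⟨ ∑-deleteXs-Xw++ a t (Y ∷ wVec as m) h ⟩
    ∑[ e < suc t ] binomᴿ a e * (∑[ u ∈ deleteXs (t ∸ e) (Y ∷ wVec as m) ] h (Xw (a ∸ e) ++ u))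
      ≈⟨ ∑<-cong (suc t) (λ e _ → *-congˡ (begin
           ∑[ u ∈ deleteXs (t ∸ e) (Y ∷ wVec as m) ] h (Xw (a ∸ e) ++ u)
             ≈⟨ ∑-deleteXs-Y∷ (t ∸ e) (wVec as m) _ ⟩
           ∑[ u ∈ deleteXs (t ∸ e) (wVec as m) ] h (Xw (a ∸ e) ++ Y ∷ u)
             ≈⟨ ∑-deleteXs-wVec as m (t ∸ e) _ ⟩
           deletionSum as m (t ∸ e) (λ bs m′ → h (Xw (a ∸ e) ++ Y ∷ wVec bs m′))
             ≈⟨ deletionSum-cong≡ as m (t ∸ e) (λ bs m′ → ≡.cong h (≡.sym (wWord-∷ (a ∸ e) (toList bs) m′))) ⟩
           deletionSum as m (t ∸ e) (λ bs m′ → h (wVec ((a ∸ e) ∷ bs) m′)) ∎)) ⟩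
    deletionSum (a ∷ as) m t (λ bs m′ → h (wVec bs m′)) ∎

  deletionSum-cong : ∀ {n} (as : Vec ℕ n) m t {H H′} →
    (∀ bs m′ → Vec.sum bs ℕ.+ m′ ℕ.+ t ≡ Vec.sum as ℕ.+ m → H bs m′ ≈ H′ bs m′) →
    deletionSum as m t H ≈ deletionSum as m t H′
  deletionSum-cong []       m t H≈H′ = binomᴿ-*-congˡ m t (λ t≤m → H≈H′ [] (m ∸ t) (ℕ.m∸n+n≡m t≤m))
  deletionSum-cong (a ∷ as) m t H≈H′ = ∑<-cong (suc t) (λ e e<1+t → binomᴿ-*-congˡ a e (λ e≤a →
    deletionSum-cong as m (t ∸ e) (λ bs m′ eq → H≈H′ _ m′ (∸-+-invariant (Vec.sum bs) m′ e≤a (ℕ.≤-pred e<1+t) eq))))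

  deletionSum-∑ : ∀ {n} {A : Set} (as : Vec ℕ n) m t (xs : List A) (H : A → Vec ℕ n → ℕ → Carrier) →
                  ∑[ x ∈ xs ] deletionSum as m t (H x) ≈ deletionSum as m t (λ bs m′ → ∑[ x ∈ xs ] H x bs m′)
  deletionSum-∑ []       m t xs H = ∑-*ˡ xs (binomᴿ m t) _
  deletionSum-∑ {A = A} (a ∷ as) m t xs H = begin
    ∑[ x ∈ xs ] ∑[ e < suc t ] binomᴿ a e * deletionSum as m (t ∸ e) (H′ x e)
      ≈⟨ ∑<-comm-∑ (suc t) xs _ ⟨
    ∑[ e < suc t ] ∑[ x ∈ xs ] binomᴿ a e * deletionSum as m (t ∸ e) (H′ x e)
      ≈⟨ ∑<-cong (suc t) (λ e _ → trans (∑-*ˡ xs (binomᴿ a e) _)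
                                        (*-congˡ (deletionSum-∑ as m (t ∸ e) xs (λ x → H′ x e)))) ⟩
    ∑[ e < suc t ] binomᴿ a e * deletionSum as m (t ∸ e) (λ bs m′ → ∑[ x ∈ xs ] H′ x e bs m′) ∎
    where
    H′ : A → ℕ → Vec ℕ _ → ℕ → Carrier
    H′ x e bs m′ = H x ((a ∸ e) ∷ bs) m′

  deletionSum-*ʳ : ∀ {n} (as : Vec ℕ n) m t (H : Vec ℕ n → ℕ → Carrier) k →
                   deletionSum as m t H * k ≈ deletionSum as m t (λ bs m′ → H bs m′ * k)
  deletionSum-*ʳ []       m t H k = *-assoc _ _ k
  deletionSum-*ʳ (a ∷ as) m t H k = begin
    (∑[ e < suc t ] binomᴿ a e * deletionSum as m (t ∸ e) (H′ e)) * k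
      ≈⟨ ∑<-*ʳ (suc t) k _ ⟨
    ∑[ e < suc t ] binomᴿ a e * deletionSum as m (t ∸ e) (H′ e) * k
      ≈⟨ ∑<-cong (suc t) (λ e _ → trans (*-assoc _ _ k) (*-congˡ (deletionSum-*ʳ as m (t ∸ e) (H′ e) k))) ⟩
    ∑[ e < suc t ] binomᴿ a e * deletionSum as m (t ∸ e) (λ bs m′ → H′ e bs m′ * k) ∎
    where
    H′ : ℕ → Vec ℕ _ → ℕ → Carrier
    H′ e bs m′ = H ((a ∸ e) ∷ bs) m′

  binomᴿ-*-δℕ : ∀ m t → binomᴿ m t * δℕ (m ∸ t) 0 ≈ ofℕ C[ 0 , t − m ]
  binomᴿ-*-δℕ zero    zero    = *-identityʳ _
  binomᴿ-*-δℕ zero    (suc t) = zeroˡ _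
  binomᴿ-*-δℕ (suc m) zero    = zeroʳ _
  binomᴿ-*-δℕ (suc m) (suc t) = begin
    binomᴿ (suc m) (suc t) * δℕ (m ∸ t) 0                     ≈⟨ *-congʳ (binomᴿ-pascal m t) ⟩
    (binomᴿ m t + binomᴿ m (suc t)) * δℕ (m ∸ t) 0           ≈⟨ distribʳ _ _ _ ⟩
    binomᴿ m t * δℕ (m ∸ t) 0 + binomᴿ m (suc t) * δℕ (m ∸ t) 0
      ≈⟨ +-cong (binomᴿ-*-δℕ m t) (trans (binomᴿ-*-congˡ m (suc t) δ≈0) (zeroʳ _)) ⟩
    ofℕ C[ 0 , t − m ] + 0#                                   ≈⟨ +-identityʳ _ ⟩
    ofℕ C[ 0 , t − m ]                                        ∎
    where
    δ≈0 : suc t ≤ m → δℕ (m ∸ t) 0 ≈ 0#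
    δ≈0 t<m = reflexive (≡.cong (λ n → δℕ n 0) (m∸n≡1+[m∸1+n] m t t<m))

  deletionSum-∏binom : ∀ {n} (as ks : Vec ℕ n) m t →
    deletionSum as m t (λ bs m′ → δℕ m′ 0 * ofℕ (∏binom bs ks)) ≈ ofℕ (∏binom as ks) * ofℕ C[ ∑∸ as ks , t − m ]
  deletionSum-∏binom []       []       m t = begin
    binomᴿ m t * (δℕ (m ∸ t) 0 * ofℕ 1)    ≈⟨ trans (sym (*-assoc _ _ _)) (*-comm _ _) ⟩
    ofℕ 1 * (binomᴿ m t * δℕ (m ∸ t) 0)    ≈⟨ *-congˡ (binomᴿ-*-δℕ m t) ⟩
    ofℕ 1 * ofℕ C[ 0 , t − m ]              ∎
  deletionSum-∏binom (a ∷ as) (k ∷ ks) m t = begin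
    ∑[ e < suc t ] binomᴿ a e * deletionSum as m (t ∸ e) (λ bs m′ → δℕ m′ 0 * ofℕ (binom (a ∸ e) k ℕ.* ∏binom bs ks))
      ≈⟨ ∑<-cong (suc t) (λ e _ → *-congˡ (begin
           deletionSum as m (t ∸ e) (λ bs m′ → δℕ m′ 0 * ofℕ (binom (a ∸ e) k ℕ.* ∏binom bs ks))
             ≈⟨ deletionSum-cong as m (t ∸ e) (λ bs m′ _ → trans (*-congˡ (trans (ofℕ-* (binom (a ∸ e) k) _) (*-comm _ _)))
                                                                  (sym (*-assoc _ _ _))) ⟩
           deletionSum as m (t ∸ e) (λ bs m′ → δℕ m′ 0 * ofℕ (∏binom bs ks) * binomᴿ (a ∸ e) k)
             ≈⟨ deletionSum-*ʳ as m (t ∸ e) _ _ ⟨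
           deletionSum as m (t ∸ e) (λ bs m′ → δℕ m′ 0 * ofℕ (∏binom bs ks)) * binomᴿ (a ∸ e) k
             ≈⟨ *-congʳ (deletionSum-∏binom as ks m (t ∸ e)) ⟩
           P * ofℕ C[ Σ′ , t ∸ e − m ] * binomᴿ (a ∸ e) k ∎)) ⟩
    ∑[ e < suc t ] binomᴿ a e * (P * ofℕ C[ Σ′ , t ∸ e − m ] * binomᴿ (a ∸ e) k)
      ≈⟨ ∑<-cong (suc t) (λ e _ → revise e) ⟩
    ∑[ e < suc t ] P * binomᴿ a k * (binomᴿ (a ∸ k) e * ofℕ C[ Σ′ , t ∸ e − m ])
      ≈⟨ ∑<-*ˡ (suc t) _ _ ⟩
    P * binomᴿ a k * (∑[ e < suc t ] binomᴿ (a ∸ k) e * ofℕ C[ Σ′ , t ∸ e − m ])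
      ≈⟨ *-congˡ (vandermonde (a ∸ k) Σ′ t m) ⟩
    P * binomᴿ a k * ofℕ C[ (a ∸ k) ℕ.+ Σ′ , t − m ]
      ≈⟨ *-congʳ (trans (*-comm _ _) (sym (ofℕ-* (binom a k) _))) ⟩
    ofℕ (binom a k ℕ.* ∏binom as ks) * ofℕ C[ (a ∸ k) ℕ.+ Σ′ , t − m ] ∎
    where
    P  = ofℕ (∏binom as ks)
    Σ′ = ∑∸ as ks

    revise : ∀ e → binomᴿ a e * (P * ofℕ C[ Σ′ , t ∸ e − m ] * binomᴿ (a ∸ e) k)
                 ≈ P * binomᴿ a k * (binomᴿ (a ∸ k) e * ofℕ C[ Σ′ , t ∸ e − m ])
    revise e = begin
      binomᴿ a e * (P * Z * binomᴿ (a ∸ e) k)    ≈⟨ solve 4 (λ x p z y → x :* (p :* z :* y) := p :* (x :* y) :* z) refl _ P Z _ ⟩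
      P * (binomᴿ a e * binomᴿ (a ∸ e) k) * Z    ≈⟨ *-congʳ (*-congˡ (binomᴿ-revision a e k)) ⟩
      P * (binomᴿ a k * binomᴿ (a ∸ k) e) * Z    ≈⟨ solve 4 (λ p x y z → p :* (x :* y) :* z := p :* x :* (y :* z)) refl P _ _ Z ⟩
      P * binomᴿ a k * (binomᴿ (a ∸ k) e * Z)    ∎
      where
      Z = ofℕ C[ Σ′ , t ∸ e − m ]

  -- The pairing with S^(τ;0)

  Pchain-∷ʳ : ∀ Q ts t → Pchain Q (ts ∷ʳ t) ≡ (Pchain Q ts ш Xpow t) ⊗ Yp
  Pchain-∷ʳ Q []        t = ≡.refl
  Pchain-∷ʳ Q (t₀ ∷ ts) t = Pchain-∷ʳ ((Q ш Xpow t₀) ⊗ Yp) ts t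

  coeffP : ∀ {n} → Vec ℕ n → Word → Carrier
  coeffP τ w = coeff (Pchain (word []) (toList τ)) w

  ⟨S,word⟩≈coeffP : ∀ {n} (τ : Vec ℕ n) w → ⟨ S (toList τ) 0 , word w ⟩ ≈ coeffP τ w
  ⟨S,word⟩≈coeffP τ w = begin
    ⟨ S (toList τ) 0 , word w ⟩                   ≈⟨ ⟨,word⟩≈coeff (S (toList τ) 0) w ⟩
    coeff (Pchain (word []) (toList τ) ш Xpow 0) w ≈⟨ coeff-шXpow (Pchain (word []) (toList τ)) 0 w ⟩
    coeffP τ w + 0#                               ≈⟨ +-identityʳ _ ⟩
    coeffP τ w                                    ∎

  coeffP-∷ʳ : ∀ {n} (τ as : Vec ℕ n) t a →
              coeffP (τ Vec.∷ʳ t) (wVec (as Vec.∷ʳ a) 0) ≈ deletionSum as a t (λ bs m → coeffP τ (wVec bs m))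
  coeffP-∷ʳ τ as t a = begin
    coeffP (τ Vec.∷ʳ t) (wVec (as Vec.∷ʳ a) 0)
      ≡⟨ ≡.cong₂ (λ ts w → coeff (Pchain (word []) ts) w) (Vec.toList-∷ʳ t τ)
                 (≡.trans (≡.cong (λ ks → wWord ks 0) (Vec.toList-∷ʳ a as)) (wWord-∷ʳ (toList as) a)) ⟩
    coeff (Pchain (word []) (toList τ ∷ʳ t)) (wVec as a ∷ʳ Y)
      ≡⟨ ≡.cong (λ P → coeff P (wVec as a ∷ʳ Y)) (Pchain-∷ʳ (word []) (toList τ) t) ⟩
    coeff ((P ш Xpow t) ⊗ Yp) (wVec as a ∷ʳ Y)
      ≈⟨ coeff-⊗Yp-∷ʳY (P ш Xpow t) (wVec as a) ⟩
    coeff (P ш Xpow t) (wVec as a)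
      ≈⟨ coeff-шXpow P t (wVec as a) ⟩
    ∑ (deleteXs t (wVec as a)) (coeff P)
      ≈⟨ ∑-deleteXs-wVec as a t (coeff P) ⟩
    deletionSum as a t (λ bs m → coeffP τ (wVec bs m)) ∎
    where
    P = Pchain (word []) (toList τ)

  -- every word of P ends with Y, or P is the empty word
  coeffP-wVec-suc : ∀ {n} (τ bs : Vec ℕ n) m → coeffP τ (wVec bs (suc m)) ≈ 0#
  coeffP-wVec-suc {zero} [] bs m = begin
    coeff (word []) (wVec bs (suc m))   ≡⟨ ≡.cong (coeff (word [])) (wWord-suc (toList bs) m) ⟩
    1# * δ [] (wVec bs m ∷ʳ X) + 0#     ≈⟨ trans (+-identityʳ _)
                                             (trans (*-congˡ (reflexive (δ[]-∷ʳ (wVec bs m) X))) (zeroʳ _)) ⟩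
    0#                                  ∎
  coeffP-wVec-suc {suc n} τ bs m with Vec.initLast τ
  ... | τ′ , t′ , eq = begin
    coeffP τ (wVec bs (suc m))
      ≡⟨ ≡.cong₂ (λ ts w → coeff (Pchain (word []) ts) w)
                 (≡.trans (≡.cong toList eq) (Vec.toList-∷ʳ t′ τ′)) (wWord-suc (toList bs) m) ⟩
    coeff (Pchain (word []) (toList τ′ ∷ʳ t′)) (wVec bs m ∷ʳ X)
      ≡⟨ ≡.cong (λ P → coeff P (wVec bs m ∷ʳ X)) (Pchain-∷ʳ (word []) (toList τ′) t′) ⟩
    coeff ((Pchain (word []) (toList τ′) ш Xpow t′) ⊗ Yp) (wVec bs m ∷ʳ X)
      ≈⟨ coeff-⊗Yp-∷ʳX (Pchain (word []) (toList τ′) ш Xpow t′) (wVec bs m) ⟩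
    0# ∎

  ∑-box-suc : ∀ d B (F : Vec ℕ (suc d) → Carrier) → ∑ (box (suc d) B) F ≈ ∑[ t < suc B ] ∑[ τ ∈ box d B ] F (t ∷ τ)
  ∑-box-suc d B F = trans (∑-concatMap (upTo (suc B)) (λ t → map (t ∷_) (box d B)) F)
                          (∑-cong (upTo (suc B)) (λ t → reflexive (∑-map (box d B) (t ∷_) F)))

  ∑-box-∷ʳ : ∀ d B (F : Vec ℕ (suc d) → Carrier) →
             ∑ (box (suc d) B) F ≈ ∑[ τ ∈ box d B ] ∑[ t < suc B ] F (τ Vec.∷ʳ t)
  ∑-box-∷ʳ zero    B F = begin
    ∑ (box 1 B) F                            ≈⟨ ∑-box-suc 0 B F ⟩
    ∑[ t < suc B ] (F (t ∷ []) + 0#)         ≈⟨ ∑<-cong (suc B) (λ _ _ → +-identityʳ _) ⟩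
    ∑[ t < suc B ] F (t ∷ [])                ≈⟨ +-identityʳ _ ⟨
    ∑[ t < suc B ] F (t ∷ []) + 0#           ∎
  ∑-box-∷ʳ (suc d) B F = begin
    ∑ (box (suc (suc d)) B) F
      ≈⟨ ∑-box-suc (suc d) B F ⟩
    ∑[ t₀ < suc B ] ∑[ τ ∈ box (suc d) B ] F (t₀ ∷ τ)
      ≈⟨ ∑<-cong (suc B) (λ t₀ _ → ∑-box-∷ʳ d B (λ τ → F (t₀ ∷ τ))) ⟩
    ∑[ t₀ < suc B ] ∑[ τ ∈ box d B ] ∑[ t < suc B ] F (t₀ ∷ (τ Vec.∷ʳ t))
      ≈⟨ ∑-box-suc d B (λ τ → ∑[ t < suc B ] F (τ Vec.∷ʳ t)) ⟨
    ∑[ τ ∈ box (suc d) B ] ∑[ t < suc B ] F (τ Vec.∷ʳ t) ∎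

  ∑-last-exponent : ∀ A d k B g → A ℕ.+ d ≤ B →
    ∑[ t < suc B ] ofℕ C[ A , t − d ] * (sign (A ℕ.+ d ∸ t) * Mweight (A ℕ.+ d ∸ t) (t ∷ []) (k ∷ []) g)
    ≈ sign (A ℕ.+ d ∸ k) * binomᴿ d k * g (A ℕ.+ d ∸ k)
  ∑-last-exponent A d k B g A+d≤B = begin
    ∑< (suc B) f
      ≡⟨ ≡.cong (λ n → ∑< n f) 1+B≡ ⟩
    ∑< (d ℕ.+ (suc A ℕ.+ r)) f
      ≈⟨ ∑<-split d _ f ⟩
    ∑< d f + ∑[ i < suc A ℕ.+ r ] f (d ℕ.+ i)
      ≈⟨ +-cong (∑<-zero d below) (∑<-split (suc A) r _) ⟩
    0# + (∑[ n < suc A ] f (d ℕ.+ n) + ∑[ i < r ] f (d ℕ.+ (suc A ℕ.+ i)))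
      ≈⟨ trans (+-identityˡ _) (trans (+-congˡ (∑<-zero r (λ i _ → above i))) (+-identityʳ _)) ⟩
    ∑[ n < suc A ] f (d ℕ.+ n)
      ≈⟨ ∑<-cong (suc A) (λ n n<1+A → middle n (ℕ.≤-pred n<1+A)) ⟩
    ∑[ n < suc A ] sign (A ∸ n) * binomᴿ A n * ([ A ∸ n ≤ k ]· binomᴿ (d ℕ.+ n) (k ∸ (A ∸ n))) * K
      ≈⟨ ∑<-*ʳ (suc A) K _ ⟩
    (∑[ n < suc A ] sign (A ∸ n) * binomᴿ A n * ([ A ∸ n ≤ k ]· binomᴿ (d ℕ.+ n) (k ∸ (A ∸ n)))) * K
      ≈⟨ *-congʳ (∑-sign-binom-[≤] A d k) ⟩
    binomᴿ d k * K
      ≈⟨ solve 3 (λ b s x → b :* (s :* x) := s :* b :* x) refl _ _ _ ⟩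
    sign m₀ * binomᴿ d k * g m₀ ∎
    where
    m₀ = A ℕ.+ d ∸ k
    K  = sign m₀ * g m₀
    r  = B ∸ (A ℕ.+ d)

    f : ℕ → Carrier
    f t = ofℕ C[ A , t − d ] * (sign (A ℕ.+ d ∸ t) * Mweight (A ℕ.+ d ∸ t) (t ∷ []) (k ∷ []) g)

    1+B≡ : suc B ≡ d ℕ.+ (suc A ℕ.+ r)
    1+B≡ = ≡.trans (≡.cong suc (≡.sym (ℕ.m+[n∸m]≡n A+d≤B))) (shuffle A d r)
      where
      shuffle : ∀ A d r → suc (A ℕ.+ d ℕ.+ r) ≡ d ℕ.+ (suc A ℕ.+ r)
      shuffle = solve-∀

    below : ∀ i → i < d → f i ≈ 0#
    below i i<d = trans (*-congʳ (reflexive (≡.cong ofℕ (C[−]-< A i<d)))) (zeroˡ _)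

    above : ∀ i → f (d ℕ.+ (suc A ℕ.+ i)) ≈ 0#
    above i = trans (*-congʳ (reflexive (≡.cong ofℕ (≡.trans (C[+−] A d (suc A ℕ.+ i)) (binom-< (s≤s (ℕ.m≤m+n A i)))))))
                    (zeroˡ _)

    middle : ∀ n → n ≤ A →
             f (d ℕ.+ n) ≈ sign (A ∸ n) * binomᴿ A n * ([ A ∸ n ≤ k ]· binomᴿ (d ℕ.+ n) (k ∸ (A ∸ n))) * K
    middle n n≤A = begin
      f (d ℕ.+ n)
        ≡⟨ ≡.cong₂ (λ b c → ofℕ b * (sign c * Mweight c ((d ℕ.+ n) ∷ []) (k ∷ []) g))
                   (C[+−] A d n) (m+n∸[n+o]≡m∸o A d n) ⟩
      binomᴿ A n * (sign (A ∸ n) * Mweight (A ∸ n) ((d ℕ.+ n) ∷ []) (k ∷ []) g)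
        ≈⟨ *-congˡ (*-congˡ (Mweight-single d k g n≤A)) ⟩
      binomᴿ A n * (sign (A ∸ n) * (([ A ∸ n ≤ k ]· binomᴿ (d ℕ.+ n) (k ∸ (A ∸ n))) * K))
        ≈⟨ solve 4 (λ b s x y → b :* (s :* (x :* y)) := s :* b :* x :* y) refl _ _ _ _ ⟩
      sign (A ∸ n) * binomᴿ A n * ([ A ∸ n ≤ k ]· binomᴿ (d ℕ.+ n) (k ∸ (A ∸ n))) * K ∎

  ∑-last-exponent-∏binom : ∀ {n} (as κ : Vec ℕ n) a k B g → Vec.sum as ℕ.+ a ≤ B →
    ∑[ t < suc B ] ofℕ (∏binom as κ) * ofℕ C[ ∑∸ as κ , t − a ]
                   * (sign (Vec.sum as ℕ.+ a ∸ t ∸ Vec.sum κ)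
                      * Mweight (Vec.sum as ℕ.+ a ∸ t ∸ Vec.sum κ) (t ∷ []) (k ∷ []) g)
    ≈ sign (Vec.sum as ℕ.+ a ∸ (Vec.sum κ ℕ.+ k)) * ofℕ (∏binom as κ ℕ.* binom a k)
      * g (Vec.sum as ℕ.+ a ∸ (Vec.sum κ ℕ.+ k))
  ∑-last-exponent-∏binom as κ a k B g Σ≤B with ∏binom as κ ℕ.≟ 0
  ... | yes ∏≡0 rewrite ∏≡0 =
    trans (∑<-zero (suc B) (λ _ _ → trans (*-congʳ (zeroˡ _)) (zeroˡ _))) (sym (trans (*-congʳ (zeroʳ _)) (zeroˡ _)))
  ... | no  ∏≢0 rewrite ∏binom≢0⇒sum≡ as κ ∏≢0 = begin
    ∑[ t < suc B ] P * ofℕ C[ A , t − a ] * (sign (carry t) * Mweight (carry t) (t ∷ []) (k ∷ []) g)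
      ≈⟨ ∑<-cong (suc B) (λ t _ → trans (*-assoc _ _ _) (*-congˡ (*-congˡ (reflexive
           (≡.cong (λ c → sign c * Mweight c (t ∷ []) (k ∷ []) g) ([m+n+o]∸p∸n≡[m+o]∸p A K a t)))))) ⟩
    ∑[ t < suc B ] P * (ofℕ C[ A , t − a ] * (sign (A ℕ.+ a ∸ t) * Mweight (A ℕ.+ a ∸ t) (t ∷ []) (k ∷ []) g))
      ≈⟨ ∑<-*ˡ (suc B) P _ ⟩
    P * (∑[ t < suc B ] ofℕ C[ A , t − a ] * (sign (A ℕ.+ a ∸ t) * Mweight (A ℕ.+ a ∸ t) (t ∷ []) (k ∷ []) g))
      ≈⟨ *-congˡ (∑-last-exponent A a k B g (ℕ.≤-trans (ℕ.+-monoˡ-≤ a (ℕ.m≤m+n A K)) Σ≤B)) ⟩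
    P * (sign (A ℕ.+ a ∸ k) * binomᴿ a k * g (A ℕ.+ a ∸ k))
      ≈⟨ solve 4 (λ p s b x → p :* (s :* b :* x) := s :* (p :* b) :* x) refl P _ _ _ ⟩
    sign (A ℕ.+ a ∸ k) * (P * binomᴿ a k) * g (A ℕ.+ a ∸ k)
      ≈⟨ *-congʳ (*-congˡ (ofℕ-* (∏binom as κ) (binom a k))) ⟨
    sign (A ℕ.+ a ∸ k) * ofℕ (∏binom as κ ℕ.* binom a k) * g (A ℕ.+ a ∸ k)
      ≡⟨ ≡.cong (λ c → sign c * ofℕ (∏binom as κ ℕ.* binom a k) * g c) ([m+n+o]∸[n+p]≡[m+o]∸p A K a k) ⟨
    sign (A ℕ.+ K ℕ.+ a ∸ (K ℕ.+ k)) * ofℕ (∏binom as κ ℕ.* binom a k) * g (A ℕ.+ K ℕ.+ a ∸ (K ℕ.+ k)) ∎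
    where
    P = ofℕ (∏binom as κ)
    A = ∑∸ as κ
    K = Vec.sum κ
    carry : ℕ → ℕ
    carry t = A ℕ.+ K ℕ.+ a ∸ t ∸ K

  ∑-coeffP-Mweight : ∀ d (as κ : Vec ℕ d) B g → Vec.sum as ≤ B →
    ∑[ τ ∈ box d B ] coeffP τ (wVec as 0) * Mweight 0 τ κ g
    ≈ sign (Vec.sum as ∸ Vec.sum κ) * ofℕ (∏binom as κ) * g (Vec.sum as ∸ Vec.sum κ)
  ∑-coeffP-Mweight zero [] [] B g _ = begin
    (1# * 1# + 0#) * g 0 + 0#   ≈⟨ trans (+-identityʳ _) (*-congʳ (trans (+-identityʳ _) (*-identityˡ 1#))) ⟩
    1# * g 0                    ≈⟨ *-congʳ (trans (*-identityˡ _) ofℕ-1) ⟨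
    1# * ofℕ 1 * g 0            ∎
  ∑-coeffP-Mweight (suc d) as κ B g Σ≤B with Vec.initLast as | Vec.initLast κ
  ... | as′ , a , ≡.refl | κ′ , k , ≡.refl = begin
    ∑[ τ ∈ box (suc d) B ] coeffP τ (wVec (as′ Vec.∷ʳ a) 0) * Mweight 0 τ (κ′ Vec.∷ʳ k) g
      ≈⟨ ∑-box-∷ʳ d B _ ⟩
    ∑[ τ ∈ box d B ] ∑[ t < suc B ] coeffP (τ Vec.∷ʳ t) (wVec (as′ Vec.∷ʳ a) 0) * Mweight 0 (τ Vec.∷ʳ t) (κ′ Vec.∷ʳ k) g
      ≈⟨ ∑-cong (box d B) (λ τ → ∑<-cong (suc B) (λ t _ →
           *-cong (coeffP-∷ʳ τ as′ t a) (reflexive (Mweight-∷ʳ 0 τ κ′ t k g)))) ⟩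
    ∑[ τ ∈ box d B ] ∑[ t < suc B ] deletionSum as′ a t (λ bs m → coeffP τ (wVec bs m)) * Mweight 0 τ κ′ (lastWeight t)
      ≈⟨ ∑<-comm-∑ (suc B) (box d B) _ ⟨
    ∑[ t < suc B ] ∑[ τ ∈ box d B ] deletionSum as′ a t (λ bs m → coeffP τ (wVec bs m)) * Mweight 0 τ κ′ (lastWeight t)
      ≈⟨ ∑<-cong (suc B) (λ t _ → summedOverτ t) ⟩
    ∑[ t < suc B ] ofℕ (∏binom as′ κ′) * ofℕ C[ ∑∸ as′ κ′ , t − a ] * (sign (carry t) * lastWeight t (carry t))
      ≈⟨ ∑-last-exponent-∏binom as′ κ′ a k B g Σ′≤B ⟩
    sign (Vec.sum as′ ℕ.+ a ∸ (Vec.sum κ′ ℕ.+ k)) * ofℕ (∏binom as′ κ′ ℕ.* binom a k)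
      * g (Vec.sum as′ ℕ.+ a ∸ (Vec.sum κ′ ℕ.+ k))
      ≡⟨ ≡.cong₂ (λ c p → sign c * ofℕ p * g c)
                 (≡.cong₂ _∸_ (sum-∷ʳ as′ a) (sum-∷ʳ κ′ k)) (∏binom-∷ʳ as′ κ′ a k) ⟨
    sign (Vec.sum (as′ Vec.∷ʳ a) ∸ Vec.sum (κ′ Vec.∷ʳ k)) * ofℕ (∏binom (as′ Vec.∷ʳ a) (κ′ Vec.∷ʳ k))
      * g (Vec.sum (as′ Vec.∷ʳ a) ∸ Vec.sum (κ′ Vec.∷ʳ k)) ∎
    where
    lastWeight : ℕ → ℕ → Carrier
    lastWeight t c = Mweight c (t ∷ []) (k ∷ []) g

    carry : ℕ → ℕ
    carry t = Vec.sum as′ ℕ.+ a ∸ t ∸ Vec.sum κ′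

    Σ′≤B : Vec.sum as′ ℕ.+ a ≤ B
    Σ′≤B = ≡.subst (_≤ B) (sum-∷ʳ as′ a) Σ≤B

    K : ℕ → Carrier
    K t = sign (carry t) * lastWeight t (carry t)

    byInduction : ∀ t bs m → Vec.sum bs ℕ.+ m ℕ.+ t ≡ Vec.sum as′ ℕ.+ a →
            ∑[ τ ∈ box d B ] coeffP τ (wVec bs m) * Mweight 0 τ κ′ (lastWeight t) ≈ δℕ m 0 * ofℕ (∏binom bs κ′) * K t
    byInduction t bs (suc m) _ = begin
      ∑[ τ ∈ box d B ] coeffP τ (wVec bs (suc m)) * Mweight 0 τ κ′ (lastWeight t)
        ≈⟨ ∑-zero (box d B) (λ τ → trans (*-congʳ (coeffP-wVec-suc τ bs m)) (zeroˡ _)) ⟩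
      0#
        ≈⟨ trans (*-congʳ (zeroˡ _)) (zeroˡ _) ⟨
      0# * ofℕ (∏binom bs κ′) * K t ∎
    byInduction t bs zero Σ≡ = begin
      ∑[ τ ∈ box d B ] coeffP τ (wVec bs 0) * Mweight 0 τ κ′ (lastWeight t)
        ≈⟨ ∑-coeffP-Mweight d bs κ′ B (lastWeight t) Σbs≤B ⟩
      sign (Vec.sum bs ∸ Vec.sum κ′) * ofℕ (∏binom bs κ′) * lastWeight t (Vec.sum bs ∸ Vec.sum κ′)
        ≡⟨ ≡.cong (λ s → sign (s ∸ Vec.sum κ′) * ofℕ (∏binom bs κ′) * lastWeight t (s ∸ Vec.sum κ′)) Σbs≡ ⟩
      sign (carry t) * ofℕ (∏binom bs κ′) * lastWeight t (carry t)
        ≈⟨ solve 3 (λ s p x → s :* p :* x := con 1 :* p :* (s :* x)) refl _ _ _ ⟩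
      1# * ofℕ (∏binom bs κ′) * K t ∎
      where
      Σbs+t≡ : Vec.sum bs ℕ.+ t ≡ Vec.sum as′ ℕ.+ a
      Σbs+t≡ = ≡.trans (≡.cong (ℕ._+ t) (≡.sym (ℕ.+-identityʳ (Vec.sum bs)))) Σ≡

      Σbs≡ : Vec.sum bs ≡ Vec.sum as′ ℕ.+ a ∸ t
      Σbs≡ = ≡.trans (≡.sym (ℕ.m+n∸n≡m (Vec.sum bs) t)) (≡.cong (_∸ t) Σbs+t≡)

      Σbs≤B : Vec.sum bs ≤ B
      Σbs≤B = ℕ.≤-trans (ℕ.m≤m+n (Vec.sum bs) t) (ℕ.≤-trans (ℕ.≤-reflexive Σbs+t≡) Σ′≤B)

    summedOverτ : ∀ t →
      ∑[ τ ∈ box d B ] deletionSum as′ a t (λ bs m → coeffP τ (wVec bs m)) * Mweight 0 τ κ′ (lastWeight t)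
      ≈ ofℕ (∏binom as′ κ′) * ofℕ C[ ∑∸ as′ κ′ , t − a ] * K t
    summedOverτ t = begin
      ∑[ τ ∈ box d B ] deletionSum as′ a t (λ bs m → coeffP τ (wVec bs m)) * Mweight 0 τ κ′ (lastWeight t)
        ≈⟨ ∑-cong (box d B) (λ τ → deletionSum-*ʳ as′ a t _ _) ⟩
      ∑[ τ ∈ box d B ] deletionSum as′ a t (λ bs m → coeffP τ (wVec bs m) * Mweight 0 τ κ′ (lastWeight t))
        ≈⟨ deletionSum-∑ as′ a t (box d B) _ ⟩
      deletionSum as′ a t (λ bs m → ∑[ τ ∈ box d B ] coeffP τ (wVec bs m) * Mweight 0 τ κ′ (lastWeight t))
        ≈⟨ deletionSum-cong as′ a t (byInduction t) ⟩
      deletionSum as′ a t (λ bs m → δℕ m 0 * ofℕ (∏binom bs κ′) * K t)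
        ≈⟨ deletionSum-*ʳ as′ a t _ (K t) ⟨
      deletionSum as′ a t (λ bs m → δℕ m 0 * ofℕ (∏binom bs κ′)) * K t
        ≈⟨ *-congʳ (deletionSum-∏binom as′ κ′ a t) ⟩
      ofℕ (∏binom as′ κ′) * ofℕ C[ ∑∸ as′ κ′ , t − a ] * K t ∎

module ExponentVectors where
  open import Data.Fin using (zero; suc)
  open import Relation.Binary.PropositionalEquality
  open import Algebra.Properties.CommutativeSemigroup ℤ.+-commutativeSemigroup using (interchange)
  open ≡-Reasoning

  sum-toList : ∀ {n} (v : Vec ℕ n) → sum (toList v) ≡ Vec.sum v
  sum-toList []      = refl
  sum-toList (a ∷ v) = cong (ℕ._+_ a) (sum-toList v)

  binomProd≡∏binom : ∀ {d} (κ : Vec ℕ d) (s : Vec ℤ d) → binomProd κ s ≡ ∏binom (addNat κ s) κ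
  binomProd≡∏binom []      []      = refl
  binomProd≡∏binom (k ∷ κ) (t ∷ s) = cong₂ ℕ._*_ (sym (binom≡C _ k)) (binomProd≡∏binom κ s)

  +-sum-addNat : ∀ {d} (κ : Vec ℕ d) (s : Vec ℤ d) → (∀ i → + 0 ℤ.≤ + lookup κ i ℤ.+ lookup s i) →
                 + Vec.sum (addNat κ s) ≡ + Vec.sum κ ℤ.+ sumℤ s
  +-sum-addNat []      []      _   = refl
  +-sum-addNat (k ∷ κ) (t ∷ s) κ+s≥0 = begin
    + (∣ + k ℤ.+ t ∣ ℕ.+ Vec.sum (addNat κ s))      ≡⟨ ℤ.pos-+ ∣ + k ℤ.+ t ∣ _ ⟩
    + ∣ + k ℤ.+ t ∣ ℤ.+ + Vec.sum (addNat κ s)      ≡⟨ cong₂ ℤ._+_ (ℤ.0≤i⇒+∣i∣≡i (κ+s≥0 zero))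
                                                                (+-sum-addNat κ s (κ+s≥0 ∘ suc)) ⟩
    (+ k ℤ.+ t) ℤ.+ (+ Vec.sum κ ℤ.+ sumℤ s)         ≡⟨ interchange (+ k) t (+ Vec.sum κ) (sumℤ s) ⟩
    (+ k ℤ.+ + Vec.sum κ) ℤ.+ (t ℤ.+ sumℤ s)         ≡⟨ cong (ℤ._+ (t ℤ.+ sumℤ s)) (ℤ.pos-+ k (Vec.sum κ)) ⟨
    + (k ℕ.+ Vec.sum κ) ℤ.+ (t ℤ.+ sumℤ s)           ∎

  sum-addNat∸sum : ∀ {d} (κ : Vec ℕ d) (s : Vec ℤ d) → (∀ i → + 0 ℤ.≤ + lookup κ i ℤ.+ lookup s i) →
                   + 0 ℤ.≤ sumℤ s → Vec.sum (addNat κ s) ∸ Vec.sum κ ≡ ∣ sumℤ s ∣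
  sum-addNat∸sum κ s κ+s≥0 s≥0 = begin
    Vec.sum (addNat κ s) ∸ Vec.sum κ           ≡⟨ cong (_∸ Vec.sum κ) (ℤ.+-injective +Σ≡) ⟩
    Vec.sum κ ℕ.+ ∣ sumℤ s ∣ ∸ Vec.sum κ       ≡⟨ ℕ.m+n∸m≡n (Vec.sum κ) _ ⟩
    ∣ sumℤ s ∣                                  ∎
    where
    +Σ≡ : + Vec.sum (addNat κ s) ≡ + (Vec.sum κ ℕ.+ ∣ sumℤ s ∣)
    +Σ≡ = begin
      + Vec.sum (addNat κ s)               ≡⟨ +-sum-addNat κ s κ+s≥0 ⟩
      + Vec.sum κ ℤ.+ sumℤ s               ≡⟨ cong (ℤ._+_ (+ Vec.sum κ)) (ℤ.0≤i⇒+∣i∣≡i s≥0) ⟨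
      + Vec.sum κ ℤ.+ + ∣ sumℤ s ∣         ≡⟨ ℤ.pos-+ (Vec.sum κ) _ ⟨
      + (Vec.sum κ ℕ.+ ∣ sumℤ s ∣)         ∎

open ExponentVectors

lemma4p2 : ∀ {c ℓ : Level} (R : CommutativeRing c ℓ) →
  let open CommutativeRing R
      open RingDefs R
  in IsIntegralDomain → CharacteristicZero →
     (d : ℕ) → 1 ≤ d → (κ : Vec ℕ d) → (s : Vec ℤ d) →
     ℤ._≤_ (+ 0) (sumℤ s) →
     (∀ (i : Fin d) → ℤ._≤_ (+ 0) (+ lookup κ i ℤ.+ lookup s i)) →
     -- the series over τ ∈ ℕ₀^d, as its partial sums over boxes {0..B}^d,
     -- which are eventually constant (for B ≥ Σ (k_i + s_i))
     (B : ℕ) → sum (toList (addNat κ s)) ≤ B →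
     sumR (map (λ τ → ⟨ S (toList τ) 0 , word (wWord (toList (addNat κ s)) 0) ⟩
                      * ⟨ M (toList τ) 0 , word (wWord (toList κ) ∣ sumℤ s ∣) ⟩)
               (box d B))
     ≈ ofℤ (ℤ._^_ (ℤ.- (+ 1)) ∣ sumℤ s ∣) * ofℕ (binomProd κ s)
-- The identity holds in every commutative ring and also for d = 0.
lemma4p2 R _ _ d _ κ s Σs≥0 κ+s≥0 B Σ≤B = begin
  ∑[ τ ∈ box d B ] ⟨ S (toList τ) 0 , word (wVec as 0) ⟩ * ⟨ M (toList τ) 0 , word (wVec κ n) ⟩
    ≈⟨ ∑-cong (box d B) (λ τ → *-cong (⟨S,word⟩≈coeffP τ (wVec as 0)) (⟨M,word⟩≈Mweight τ κ n)) ⟩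
  ∑[ τ ∈ box d B ] coeffP τ (wVec as 0) * Mweight 0 τ κ (λ c → δℕ c n)
    ≈⟨ ∑-coeffP-Mweight d as κ B _ (≡.subst (_≤ B) (sum-toList as) Σ≤B) ⟩
  sign (Vec.sum as ∸ Vec.sum κ) * ofℕ (∏binom as κ) * δℕ (Vec.sum as ∸ Vec.sum κ) n
    ≡⟨ ≡.cong (λ m → sign m * ofℕ (∏binom as κ) * δℕ m n) (sum-addNat∸sum κ s κ+s≥0 Σs≥0) ⟩
  sign n * ofℕ (∏binom as κ) * δℕ n n
    ≈⟨ trans (*-congˡ (reflexive (δℕ-refl n))) (*-identityʳ _) ⟩
  sign n * ofℕ (∏binom as κ)
    ≈⟨ *-cong (ofℤ-[-1]^ n) (reflexive (≡.cong ofℕ (binomProd≡∏binom κ s))) ⟨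
  ofℤ (ℤ._^_ (ℤ.- (+ 1)) n) * ofℕ (binomProd κ s) ∎
  where
  open CommutativeRing R
  open RingDefs R
  open Pairings R
  open import Relation.Binary.Reasoning.Setoid setoid
  as = addNat κ s
  n  = ∣ sumℤ s ∣
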